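{- Let $n\ge1$, $c=(c_1,\dots,c_{n+1})\in\mathbb{Z}_{\ge0}^{n+1}$ and $(i_1,\dots,i_n)\in\mathbb{Z}_{\ge0}^n$, let $m=i_1+\dots+i_n$, and assume $c_{n+1}+m>0$. Let $F$ be the set of all maps $f:\{1,\dots,m\}\to\{1,\dots,n\}$ with $|f^{ -1}(j)|=i_j$ for $j=1,\dots,n$. Then the limit $$B_c(i_1,\dots,i_n)=\lim_{i_{n+1}\to\infty}\frac{A_c(i_1,\dots,i_n,i_{n+1})}{(c_{n+1}+m)^{i_{n+1}}}$$ exists and equals $$\frac{(c_{n+1}+m)^m}{m!}\sum_{f\in F}\prod_{j=1}^{m}\,(c_{f(j)}+c_{n+1}+j-1).$$
   Context: Let $e_1,\dots,e_{n+1}$ be the standard basis vectors of $\mathbb{Z}^{n+1}$. For $c\in\mathbb{Z}_{\ge0}^{n+1}$, the graph $E_c$ is the directed multigraph with vertex set $\mathbb{Z}_{\ge0}^{n+1}$ in which each vertex $i=(i_1,\dots,i_{n+1})$ is joined to $i+e_j$ by exactly $c_j+i_{n+1}$ directed edges for $1\le j\le n$, and to $i+e_{n+1}$ by exactly $c_{n+1}+i_1+\dots+i_n$ directed edges, and to no other vertices. For $i\in\mathbb{Z}_{\ge0}^{n+1}$, $A_c(i)$ denotes the number of directed paths in $E_c$ from $0$ to $i$. -}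

module Defs where

open import Data.Nat using (ℕ; zero; suc; _+_; _*_; _∸_; _^_; _!; _≡ᵇ_)
open import Data.Fin using (Fin; toℕ; _≟_)
open import Data.Bool using (Bool; true; false; if_then_else_; _∧_)
open import Data.List using (List; []; _∷_; map; concatMap)
open import Data.Nat.ListAction using (sum)
open import Data.Integer using (+_)
open import Data.Rational using (ℚ; _/_; 0ℚ)
open import Relation.Nullary.Decidable using (⌊_⌋)

Σᶠ : (n : ℕ) → (Fin n → ℕ) → ℕ
Σᶠ zero    f = 0
Σᶠ (suc n) f = f Data.Fin.zero + Σᶠ n (λ x → f (Data.Fin.suc x))

Πᶠ : (m : ℕ) → (Fin m → ℕ) → ℕ
Πᶠ zero    f = 1
Πᶠ (suc m) f = f Data.Fin.zero * Πᶠ m (λ x → f (Data.Fin.suc x))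

allᶠ : (n : ℕ) → (Fin n → Bool) → Bool
allᶠ zero    p = true
allᶠ (suc n) p = p Data.Fin.zero ∧ allᶠ n (λ x → p (Data.Fin.suc x))

dec : {n : ℕ} → (Fin n → ℕ) → Fin n → (Fin n → ℕ)
dec i j x = if ⌊ x ≟ j ⌋ then i j ∸ 1 else i x

-- Vertices of E_c are pairs (i , k) with i = (i_1,…,i_n) : Fin n → ℕ and
-- k = i_{n+1}.  The parameter c = (c_1,…,c_{n+1}) is given as
-- (cs : Fin n → ℕ) and (c' : ℕ) = c_{n+1}.
-- pathsE n cs c' ℓ i k = number of directed paths of length ℓ in E_c
-- from 0 to (i , k), computed by splitting on the last edge:
--  * edge from (i - e_j , k) to (i , k): multiplicity c_j + k
--  * edge from (i , k-1) to (i , k): multiplicity c_{n+1} + i_1 + … + i_n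
pathsE : (n : ℕ) → (Fin n → ℕ) → ℕ → ℕ → (Fin n → ℕ) → ℕ → ℕ
pathsE n cs c' zero i k =
  if (Σᶠ n i ≡ᵇ 0) ∧ (k ≡ᵇ 0) then 1 else 0
pathsE n cs c' (suc ℓ) i k =
  Σᶠ n (λ j → stepJ j (i j))
  + stepLast k
  where
    stepJ : Fin n → ℕ → ℕ
    stepJ j zero    = 0
    stepJ j (suc _) = (cs j + k) * pathsE n cs c' ℓ (dec i j) k
    stepLast : ℕ → ℕ
    stepLast zero     = 0
    stepLast (suc k') = (c' + Σᶠ n i) * pathsE n cs c' ℓ i k'

-- A_c(i_1,…,i_n,k): number of directed paths in E_c from 0 to (i , k).
-- Every edge raises the coordinate sum by one, so all such paths have
-- length i_1 + … + i_n + k.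
A : (n : ℕ) → (Fin n → ℕ) → ℕ → (Fin n → ℕ) → ℕ → ℕ
A n cs c' i k = pathsE n cs c' (Σᶠ n i + k) i k

consF : {m n : ℕ} → Fin n → (Fin m → Fin n) → (Fin (suc m) → Fin n)
consF a f Data.Fin.zero    = a
consF a f (Data.Fin.suc x) = f x

allFins : (n : ℕ) → List (Fin n)
allFins zero    = []
allFins (suc n) = Data.Fin.zero ∷ map Data.Fin.suc (allFins n)

allFuns : (m n : ℕ) → List (Fin m → Fin n)
allFuns zero    n = (λ ()) ∷ []
allFuns (suc m) n = concatMap (λ f → map (λ a → consF a f) (allFins n)) (allFuns m n)

fiber : {m n : ℕ} → (Fin m → Fin n) → Fin n → ℕ
fiber {m} f j = Σᶠ m (λ x → if ⌊ f x ≟ j ⌋ then 1 else 0)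

inF : {m n : ℕ} → (Fin n → ℕ) → (Fin m → Fin n) → Bool
inF {m} {n} i f = allᶠ n (λ j → fiber f j ≡ᵇ i j)

-- Σ_{f ∈ F} Π_{j=1}^{m} (c_{f(j)} + c_{n+1} + j - 1)   (x = j - 1 below)
sumF : (n : ℕ) → (Fin n → ℕ) → ℕ → (Fin n → ℕ) → ℕ
sumF n cs c' i = sum (map term (allFuns m n))
  where
    m = Σᶠ n i
    term : (Fin m → Fin n) → ℕ
    term f = if inF i f then Πᶠ m (λ x → cs (f x) + c' + toℕ x) else 0

-- a / d as a rational; d = 0 is junk (never used under the hypotheses)
ratio : ℕ → ℕ → ℚ
ratio a zero    = 0ℚ
ratio a (suc d) = (+ a) / suc d

-- Multiplied by m!, the path count A_c(i, k) and its predicted value (c_{n+1} + m)^(m+k) Σ_{f ∈ F} Π_j (…)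
-- satisfy the same recursion in k, obtained by removing the first edge of a path (for A this needs that
-- decompositions by the first and by the last edge agree). Induction on m, and then on k, bounds their
-- difference by a polynomial in k times (c_{n+1} + m - 1)^k, which becomes negligible after dividing
-- by (c_{n+1} + m)^k, since an exponential with a larger base dominates any polynomial.
module Submission where

open import Defs
open import Data.Nat using (ℕ; suc; _+_; _*_; _^_; _!; _<_; _≥_)
open import Data.Fin using (Fin)
open import Data.Product using (Σ)
open import Data.Rational using (ℚ; 0ℚ; _-_; ∣_∣) renaming (_<_ to _<ℚ_)

open import Data.Bool using (Bool; true; false; if_then_else_; _∧_)
open import Data.Empty using (⊥-elim)
open import Data.Fin using (toℕ; _≟_)
import Data.Fin as F
import Data.Fin.Properties as F
open import Data.Integer as ℤ using (ℤ; +[1+_]; -[1+_]; _⊖_)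
import Data.Integer.Properties as ℤ
open import Data.List using (List; []; _∷_; _++_; map; concatMap)
open import Data.List.Properties using (map-++; map-cong; map-∘)
open import Data.Nat using (zero; _∸_; _≤_; _>_; z≤n; s≤s; _≡ᵇ_; _/_; _%_; NonZero; >-nonZero)
  renaming (∣_-_∣ to dist)
open import Data.Nat.DivMod using (m≡m%n+[m/n]*n; m%n<n; m*n/n≡m; /-monoˡ-≤)
open import Data.Nat.ListAction using (sum)
open import Data.Nat.ListAction.Properties using (sum-++)
open import Data.Nat.Properties hiding (_≟_)
open import Data.Nat.Tactic.RingSolver using (solve-∀)
open import Data.Product using (_,_; proj₁; proj₂)
import Data.Rational as ℚ
open import Data.Rational using (mkℚ; toℚᵘ; fromℚᵘ)
open import Data.Rational.Properties using (toℚᵘ-cancel-<; toℚᵘ-homo-∣-∣; toℚᵘ-homo-+; toℚᵘ-homo‿-; toℚᵘ-fromℚᵘ)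
import Data.Rational.Unnormalised as ℚᵘ
import Data.Rational.Unnormalised.Properties as ℚᵘ
open import Data.Sum using (inj₁; inj₂)
open import Function using (_∘_)
open import Relation.Nullary using (¬_; Dec; yes; no)
open import Relation.Nullary.Decidable using (⌊_⌋)
open import Relation.Binary.PropositionalEquality

Σᶠ-cong : ∀ {n} {f g : Fin n → ℕ} → f ≗ g → Σᶠ n f ≡ Σᶠ n g
Σᶠ-cong {zero}  f≗g = refl
Σᶠ-cong {suc n} f≗g = cong₂ _+_ (f≗g F.zero) (Σᶠ-cong (f≗g ∘ F.suc))

Σᶠ-zero : ∀ n → Σᶠ n (λ _ → 0) ≡ 0
Σᶠ-zero zero    = refl
Σᶠ-zero (suc n) = Σᶠ-zero n

Σᶠ-distrib-+ : ∀ n (f g : Fin n → ℕ) → Σᶠ n (λ x → f x + g x) ≡ Σᶠ n f + Σᶠ n g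
Σᶠ-distrib-+ zero    f g = refl
Σᶠ-distrib-+ (suc n) f g =
  trans (cong (f F.zero + g F.zero +_) (Σᶠ-distrib-+ n (f ∘ F.suc) (g ∘ F.suc)))
        (+-interchange (f F.zero) _ _ _)
  where
  +-interchange : ∀ a b c d → a + b + (c + d) ≡ a + c + (b + d)
  +-interchange = solve-∀

*-distribˡ-Σᶠ : ∀ n a (f : Fin n → ℕ) → a * Σᶠ n f ≡ Σᶠ n (λ x → a * f x)
*-distribˡ-Σᶠ zero    a f = *-zeroʳ a
*-distribˡ-Σᶠ (suc n) a f =
  trans (*-distribˡ-+ a (f F.zero) _) (cong (a * f F.zero +_) (*-distribˡ-Σᶠ n a (f ∘ F.suc)))

Σᶠ-comm : ∀ n m (f : Fin n → Fin m → ℕ) →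
  Σᶠ n (λ x → Σᶠ m (f x)) ≡ Σᶠ m (λ y → Σᶠ n (λ x → f x y))
Σᶠ-comm zero    m f = sym (Σᶠ-zero m)
Σᶠ-comm (suc n) m f =
  trans (cong (Σᶠ m (f F.zero) +_) (Σᶠ-comm n m (f ∘ F.suc))) (sym (Σᶠ-distrib-+ m (f F.zero) _))

f≤Σᶠ : ∀ n (f : Fin n → ℕ) j → f j ≤ Σᶠ n f
f≤Σᶠ (suc n) f F.zero    = m≤m+n _ _
f≤Σᶠ (suc n) f (F.suc j) = ≤-trans (f≤Σᶠ n (f ∘ F.suc) j) (m≤n+m _ _)

Σᶠ≡0⇒≡0 : ∀ n (f : Fin n → ℕ) → Σᶠ n f ≡ 0 → ∀ j → f j ≡ 0
Σᶠ≡0⇒≡0 n f Σf≡0 j = n≤0⇒n≡0 (subst (f j ≤_) Σf≡0 (f≤Σᶠ n f j))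

Σᶠ-≤-* : ∀ n {f : Fin n → ℕ} b → (∀ x → f x ≤ b) → Σᶠ n f ≤ n * b
Σᶠ-≤-* zero    b f≤b = z≤n
Σᶠ-≤-* (suc n) b f≤b = +-mono-≤ (f≤b F.zero) (Σᶠ-≤-* n b (f≤b ∘ F.suc))

Σᶠ-scaled-distrib-+ : ∀ n (a b x y : Fin n → ℕ) →
  Σᶠ n (λ l → a l * (b l * (x l + y l))) ≡ Σᶠ n (λ l → a l * (b l * x l)) + Σᶠ n (λ l → a l * (b l * y l))
Σᶠ-scaled-distrib-+ n a b x y =
  trans (Σᶠ-cong (λ l → distrib (a l) (b l) (x l) (y l))) (Σᶠ-distrib-+ n _ _)
  where
  distrib : ∀ a b x y → a * (b * (x + y)) ≡ a * (b * x) + a * (b * y)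
  distrib = solve-∀

*-^-distrib : ∀ a b m → (a * b) ^ m ≡ a ^ m * b ^ m
*-^-distrib a b zero    = refl
*-^-distrib a b (suc m) = trans (cong (a * b *_) (*-^-distrib a b m)) (interchange a b (a ^ m) (b ^ m))
  where
  interchange : ∀ a b x y → a * b * (x * y) ≡ a * x * (b * y)
  interchange = solve-∀

sgn : ℕ → ℕ
sgn zero    = 0
sgn (suc _) = 1

sgn*-identity : ∀ {a b y} → a ≡ suc b → sgn a * y ≡ y
sgn*-identity refl = *-identityˡ _

sgn*-cong : ∀ a {x y} → (∀ {b} → a ≡ suc b → x ≡ y) → sgn a * x ≡ sgn a * y
sgn*-cong zero    x≡y = refl
sgn*-cong (suc b) x≡y = cong (1 *_) (x≡y refl)

sgn*≤ : ∀ a x → sgn a * x ≤ x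
sgn*≤ zero    x = z≤n
sgn*≤ (suc a) x = ≤-reflexive (*-identityˡ x)

sgn*-mono-≤ : ∀ a {x y} → (∀ {b} → a ≡ suc b → x ≤ y) → sgn a * x ≤ sgn a * y
sgn*-mono-≤ zero    x≤y = z≤n
sgn*-mono-≤ (suc b) x≤y = *-monoʳ-≤ 1 (x≤y refl)

Σᶠ-sgn≡0 : ∀ n (i X : Fin n → ℕ) → Σᶠ n i ≡ 0 → Σᶠ n (λ j → sgn (i j) * X j) ≡ 0
Σᶠ-sgn≡0 n i X Σi≡0 =
  trans (Σᶠ-cong (λ j → cong (λ v → sgn v * X j) (Σᶠ≡0⇒≡0 n i Σi≡0 j))) (Σᶠ-zero n)

dec-≡ : ∀ {n} (i : Fin n → ℕ) j → dec i j j ≡ i j ∸ 1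
dec-≡ i j with j ≟ j
... | yes _  = refl
... | no j≢j = ⊥-elim (j≢j refl)

dec-≢ : ∀ {n} (i : Fin n → ℕ) {j x} → ¬ x ≡ j → dec i j x ≡ i x
dec-≢ i {j} {x} x≢j with x ≟ j
... | yes x≡j = ⊥-elim (x≢j x≡j)
... | no _    = refl

dec-cong : ∀ {n} {i i′ : Fin n → ℕ} → i ≗ i′ → ∀ j → dec i j ≗ dec i′ j
dec-cong i≗i′ j x with x ≟ j
... | yes _ = cong (_∸ 1) (i≗i′ j)
... | no _  = i≗i′ x

dec-comm : ∀ {n} (i : Fin n → ℕ) {l j} → ¬ l ≡ j → dec (dec i l) j ≗ dec (dec i j) l
dec-comm i {l} {j} l≢j x with x ≟ j | x ≟ l
... | yes refl | yes refl = ⊥-elim (l≢j refl)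
... | yes refl | no x≢l   = cong (_∸ 1) (dec-≢ i x≢l)
... | no x≢j   | yes refl = cong (_∸ 1) (sym (dec-≢ i x≢j))
... | no _     | no _     = refl

dec-suc : ∀ {n} (i : Fin (suc n) → ℕ) j → dec i (F.suc j) ∘ F.suc ≗ dec (i ∘ F.suc) j
dec-suc i j x = by-cases (x ≟ j)
  where
  by-cases : Dec (x ≡ j) → dec i (F.suc j) (F.suc x) ≡ dec (i ∘ F.suc) j x
  by-cases (yes refl) = trans (dec-≡ i (F.suc x)) (sym (dec-≡ (i ∘ F.suc) x))
  by-cases (no x≢j)   = trans (dec-≢ i (x≢j ∘ F.suc-injective)) (sym (dec-≢ (i ∘ F.suc) x≢j))

Σᶠ-dec : ∀ {n} (i : Fin n → ℕ) j {a} → i j ≡ suc a → suc (Σᶠ n (dec i j)) ≡ Σᶠ n i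
Σᶠ-dec i F.zero    ij≡1+a rewrite ij≡1+a = refl
Σᶠ-dec i (F.suc j) ij≡1+a = begin
  suc (i F.zero + Σᶠ _ (dec i (F.suc j) ∘ F.suc)) ≡⟨ sym (+-suc (i F.zero) _) ⟩
  i F.zero + suc (Σᶠ _ (dec i (F.suc j) ∘ F.suc)) ≡⟨ cong (λ s → i F.zero + suc s) (Σᶠ-cong (dec-suc i j)) ⟩
  i F.zero + suc (Σᶠ _ (dec (i ∘ F.suc) j))       ≡⟨ cong (i F.zero +_) (Σᶠ-dec (i ∘ F.suc) j ij≡1+a) ⟩
  i F.zero + Σᶠ _ (i ∘ F.suc)                     ∎
  where open ≡-Reasoning

atOrigin : ℕ → ℕ → ℕ
atOrigin m       (suc k) = 0
atOrigin zero    zero    = 1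
atOrigin (suc m) zero    = 0

atOrigin-suc : ∀ {m k L} → m + k ≡ suc L → atOrigin m k ≡ 0
atOrigin-suc {m}     {suc k} _ = refl
atOrigin-suc {suc m} {zero}  _ = refl

m*atOrigin≡0 : ∀ m k → m * atOrigin m k ≡ 0
m*atOrigin≡0 m       (suc k) = *-zeroʳ m
m*atOrigin≡0 zero    zero    = refl
m*atOrigin≡0 (suc m) zero    = *-zeroʳ (suc m)

atOrigin≤1 : ∀ m k → atOrigin m k ≤ 1
atOrigin≤1 m       (suc k) = z≤n
atOrigin≤1 zero    zero    = ≤-refl
atOrigin≤1 (suc m) zero    = z≤n

pathsE-zero : ∀ n cs c' i k → pathsE n cs c' 0 i k ≡ atOrigin (Σᶠ n i) k
pathsE-zero n cs c' i k with Σᶠ n i | k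
... | zero  | zero  = refl
... | zero  | suc _ = refl
... | suc _ | zero  = refl
... | suc _ | suc _ = refl

-- Needed because `with i j` also abstracts the `i j` inside the unfolded `dec i j`.
pathsE-at-dec : ∀ n cs c' ℓ (i : Fin n → ℕ) j k {v} → i j ≡ v →
  pathsE n cs c' ℓ (dec i j) k ≡ pathsE n cs c' ℓ (λ x → if ⌊ x ≟ j ⌋ then v ∸ 1 else i x) k
pathsE-at-dec n cs c' ℓ i j k refl = refl

pathsE-suc : ∀ n cs c' ℓ i k → pathsE n cs c' (suc ℓ) i k ≡
  Σᶠ n (λ j → sgn (i j) * ((cs j + k) * pathsE n cs c' ℓ (dec i j) k))
  + sgn k * ((c' + Σᶠ n i) * pathsE n cs c' ℓ i (k ∸ 1))
pathsE-suc n cs c' ℓ i zero = trans unfold (cong (_+ 0) (Σᶠ-cong edge))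
  where
  -- the summands of the defining clause of pathsE, which lives in a where block of Defs
  edges : Fin n → ℕ
  edges = _
  unfold : pathsE n cs c' (suc ℓ) i 0 ≡ Σᶠ n edges + 0
  unfold = refl
  edge : ∀ j → edges j ≡ sgn (i j) * ((cs j + 0) * pathsE n cs c' ℓ (dec i j) 0)
  edge j with i j in ij≡v
  ... | zero  = refl
  ... | suc _ = trans (cong ((cs j + 0) *_) (pathsE-at-dec n cs c' ℓ i j 0 ij≡v)) (sym (+-identityʳ _))
pathsE-suc n cs c' ℓ i (suc k) = trans unfold (cong₂ _+_ (Σᶠ-cong edge) (sym (+-identityʳ _)))
  where
  edges : Fin n → ℕ
  edges = _
  unfold : pathsE n cs c' (suc ℓ) i (suc k) ≡ Σᶠ n edges + (c' + Σᶠ n i) * pathsE n cs c' ℓ i k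
  unfold = refl
  edge : ∀ j → edges j ≡ sgn (i j) * ((cs j + suc k) * pathsE n cs c' ℓ (dec i j) (suc k))
  edge j with i j in ij≡v
  ... | zero  = refl
  ... | suc _ = trans (cong ((cs j + suc k) *_) (pathsE-at-dec n cs c' ℓ i j (suc k) ij≡v)) (sym (+-identityʳ _))

pathsE-cong : ∀ n cs c' ℓ {i i′ : Fin n → ℕ} k → i ≗ i′ → pathsE n cs c' ℓ i k ≡ pathsE n cs c' ℓ i′ k
pathsE-cong n cs c' zero    k i≗i′ =
  cong (λ s → if (s ≡ᵇ 0) ∧ (k ≡ᵇ 0) then 1 else 0) (Σᶠ-cong i≗i′)
pathsE-cong n cs c' (suc ℓ) {i} {i′} k i≗i′ = begin
  pathsE n cs c' (suc ℓ) i k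
    ≡⟨ pathsE-suc n cs c' ℓ i k ⟩
  Σᶠ n (λ j → sgn (i j) * ((cs j + k) * pathsE n cs c' ℓ (dec i j) k))
    + sgn k * ((c' + Σᶠ n i) * pathsE n cs c' ℓ i (k ∸ 1))
    ≡⟨ cong₂ _+_ (Σᶠ-cong (λ j → cong₂ (λ a b → sgn a * ((cs j + k) * b)) (i≗i′ j)
                                        (pathsE-cong n cs c' ℓ k (dec-cong i≗i′ j))))
                 (cong₂ (λ s b → sgn k * ((c' + s) * b)) (Σᶠ-cong i≗i′) (pathsE-cong n cs c' ℓ (k ∸ 1) i≗i′)) ⟩
  Σᶠ n (λ j → sgn (i′ j) * ((cs j + k) * pathsE n cs c' ℓ (dec i′ j) k))
    + sgn k * ((c' + Σᶠ n i′) * pathsE n cs c' ℓ i′ (k ∸ 1))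
    ≡⟨ pathsE-suc n cs c' ℓ i′ k ⟨
  pathsE n cs c' (suc ℓ) i′ k
    ∎
  where open ≡-Reasoning

A-cong : ∀ n cs c' {i i′ : Fin n → ℕ} k → i ≗ i′ → A n cs c' i k ≡ A n cs c' i′ k
A-cong n cs c' {i} {i′} k i≗i′ =
  trans (cong (λ ℓ → pathsE n cs c' ℓ i k) (cong (_+ k) (Σᶠ-cong i≗i′))) (pathsE-cong n cs c' (Σᶠ n i′ + k) k i≗i′)

lastStep : (n : ℕ) → (Fin n → ℕ) → ℕ → (Fin n → ℕ) → ℕ → ℕ
lastStep n cs c' i k =
  Σᶠ n (λ j → sgn (i j) * ((cs j + k) * A n cs c' (dec i j) k))
  + sgn k * ((c' + Σᶠ n i) * A n cs c' i (k ∸ 1))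

lastStep-at-origin : ∀ n cs c' (i : Fin n → ℕ) k → Σᶠ n i + k ≡ 0 → lastStep n cs c' i k ≡ 0
lastStep-at-origin n cs c' i k total≡0 =
  cong₂ _+_ (Σᶠ-sgn≡0 n i (λ j → (cs j + k) * A n cs c' (dec i j) k) (m+n≡0⇒m≡0 (Σᶠ n i) total≡0))
            (cong (λ v → sgn v * ((c' + Σᶠ n i) * A n cs c' i (k ∸ 1))) (m+n≡0⇒n≡0 (Σᶠ n i) total≡0))

A-lastStep : ∀ n cs c' i k → A n cs c' i k ≡ lastStep n cs c' i k + atOrigin (Σᶠ n i) k
A-lastStep n cs c' i k = at-length (Σᶠ n i + k) refl
  where
  at-length : ∀ ℓ → Σᶠ n i + k ≡ ℓ → pathsE n cs c' ℓ i k ≡ lastStep n cs c' i k + atOrigin (Σᶠ n i) k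
  at-length zero    len≡0 =
    trans (pathsE-zero n cs c' i k) (sym (cong (_+ atOrigin (Σᶠ n i) k) (lastStep-at-origin n cs c' i k len≡0)))
  at-length (suc ℓ) len≡1+ℓ = begin
    pathsE n cs c' (suc ℓ) i k
      ≡⟨ pathsE-suc n cs c' ℓ i k ⟩
    Σᶠ n (λ j → sgn (i j) * ((cs j + k) * pathsE n cs c' ℓ (dec i j) k))
      + sgn k * ((c' + Σᶠ n i) * pathsE n cs c' ℓ i (k ∸ 1))
      ≡⟨ cong₂ _+_ (Σᶠ-cong (λ j → sgn*-cong (i j) (λ ij≡1+b → cong (λ ℓ → (cs j + k) * pathsE n cs c' ℓ (dec i j) k) (dec-length j ij≡1+b))))
                   (sgn*-cong k (λ k≡1+k′ → cong (λ ℓ → (c' + Σᶠ n i) * pathsE n cs c' ℓ i (k ∸ 1)) (pred-length k≡1+k′))) ⟩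
    lastStep n cs c' i k
      ≡⟨ +-identityʳ _ ⟨
    lastStep n cs c' i k + 0
      ≡⟨ cong (lastStep n cs c' i k +_) (atOrigin-suc len≡1+ℓ) ⟨
    lastStep n cs c' i k + atOrigin (Σᶠ n i) k
      ∎
    where
    open ≡-Reasoning
    dec-length : ∀ j {b} → i j ≡ suc b → ℓ ≡ Σᶠ n (dec i j) + k
    dec-length j ij≡1+b = suc-injective (trans (sym len≡1+ℓ) (cong (_+ k) (sym (Σᶠ-dec i j ij≡1+b))))
    pred-length : ∀ {k′} → k ≡ suc k′ → ℓ ≡ Σᶠ n i + (k ∸ 1)
    pred-length {k′} k≡1+k′ = suc-injective (begin
      suc ℓ                  ≡⟨ len≡1+ℓ ⟨
      Σᶠ n i + k             ≡⟨ cong (Σᶠ n i +_) k≡1+k′ ⟩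
      Σᶠ n i + suc k′        ≡⟨ +-suc (Σᶠ n i) k′ ⟩
      suc (Σᶠ n i + k′)      ≡⟨ cong (λ k → suc (Σᶠ n i + (k ∸ 1))) k≡1+k′ ⟨
      suc (Σᶠ n i + (k ∸ 1)) ∎)

module _ {n : ℕ} (T : (Fin n → ℕ) → ℕ) (T-cong : ∀ {u v} → u ≗ v → T u ≡ T v) where

  twoSteps : (Fin n → ℕ) → Fin n → Fin n → ℕ
  twoSteps i l j = sgn (i l) * sgn (dec i l j) * T (dec (dec i l) j)

  twoSteps-comm : ∀ i l j → twoSteps i l j ≡ twoSteps i j l
  twoSteps-comm i l j = by-cases (l ≟ j)
    where
    open ≡-Reasoning
    by-cases : Dec (l ≡ j) → twoSteps i l j ≡ twoSteps i j l
    by-cases (yes refl) = refl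
    by-cases (no l≢j)   = begin
      sgn (i l) * sgn (dec i l j) * T (dec (dec i l) j)
        ≡⟨ cong₂ (λ a t → sgn (i l) * sgn a * t) (dec-≢ i (l≢j ∘ sym)) (T-cong (dec-comm i l≢j)) ⟩
      sgn (i l) * sgn (i j) * T (dec (dec i j) l)
        ≡⟨ cong (_* T (dec (dec i j) l)) (*-comm (sgn (i l)) (sgn (i j))) ⟩
      sgn (i j) * sgn (i l) * T (dec (dec i j) l)
        ≡⟨ cong (λ a → sgn (i j) * sgn a * T (dec (dec i j) l)) (dec-≢ i l≢j) ⟨
      sgn (i j) * sgn (dec i j l) * T (dec (dec i j) l)
        ∎

  Σᶠ-dec-comm : ∀ (i α β : Fin n → ℕ) →
    Σᶠ n (λ l → sgn (i l) * (α l * Σᶠ n (λ j → sgn (dec i l j) * (β j * T (dec (dec i l) j)))))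
    ≡ Σᶠ n (λ j → sgn (i j) * (β j * Σᶠ n (λ l → sgn (dec i j l) * (α l * T (dec (dec i j) l)))))
  Σᶠ-dec-comm i α β = begin
    Σᶠ n (λ l → sgn (i l) * (α l * Σᶠ n (λ j → sgn (dec i l j) * (β j * T (dec (dec i l) j)))))
      ≡⟨ Σᶠ-cong (λ l → expand α β l) ⟩
    Σᶠ n (λ l → Σᶠ n (λ j → α l * β j * twoSteps i l j))
      ≡⟨ Σᶠ-cong (λ l → Σᶠ-cong (λ j → cong₂ _*_ (*-comm (α l) (β j)) (twoSteps-comm i l j))) ⟩
    Σᶠ n (λ l → Σᶠ n (λ j → β j * α l * twoSteps i j l))
      ≡⟨ Σᶠ-comm n n (λ l j → β j * α l * twoSteps i j l) ⟩
    Σᶠ n (λ j → Σᶠ n (λ l → β j * α l * twoSteps i j l))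
      ≡⟨ Σᶠ-cong (λ j → expand β α j) ⟨
    Σᶠ n (λ j → sgn (i j) * (β j * Σᶠ n (λ l → sgn (dec i j l) * (α l * T (dec (dec i j) l)))))
      ∎
    where
    open ≡-Reasoning
    reassoc : ∀ s a t b x → s * (a * (t * (b * x))) ≡ a * b * (s * t * x)
    reassoc = solve-∀
    expand : ∀ (α β : Fin n → ℕ) l →
      sgn (i l) * (α l * Σᶠ n (λ j → sgn (dec i l j) * (β j * T (dec (dec i l) j))))
      ≡ Σᶠ n (λ j → α l * β j * twoSteps i l j)
    expand α β l = begin
      sgn (i l) * (α l * Σᶠ n (λ j → sgn (dec i l j) * (β j * T (dec (dec i l) j))))
        ≡⟨ cong (sgn (i l) *_) (*-distribˡ-Σᶠ n (α l) _) ⟩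
      sgn (i l) * Σᶠ n (λ j → α l * (sgn (dec i l j) * (β j * T (dec (dec i l) j))))
        ≡⟨ *-distribˡ-Σᶠ n (sgn (i l)) _ ⟩
      Σᶠ n (λ j → sgn (i l) * (α l * (sgn (dec i l j) * (β j * T (dec (dec i l) j)))))
        ≡⟨ Σᶠ-cong (λ j → reassoc (sgn (i l)) (α l) (sgn (dec i l j)) (β j) (T (dec (dec i l) j))) ⟩
      Σᶠ n (λ j → α l * β j * twoSteps i l j)
        ∎

-- Removing the first edge of a path: above e_{n+1} the graph is E_c with every c_j
-- raised by one, above e_j it is E_c with c_{n+1} raised by one.
firstStep : (n : ℕ) → (Fin n → ℕ) → ℕ → (Fin n → ℕ) → ℕ → ℕ
firstStep n cs c' i k =
  sgn k * (c' * A n (suc ∘ cs) c' i (k ∸ 1))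
  + Σᶠ n (λ j → sgn (i j) * (cs j * A n cs (suc c') (dec i j) k))

module _ (n : ℕ) where

  FirstStepAt : ℕ → Set
  FirstStepAt N = ∀ cs c' (i : Fin n → ℕ) k → Σᶠ n i + k ≡ N →
    A n cs c' i k ≡ firstStep n cs c' i k + atOrigin (Σᶠ n i) k

  private
    dec-total : ∀ {i : Fin n → ℕ} {k N} j {b} → Σᶠ n i + k ≡ suc N → i j ≡ suc b → Σᶠ n (dec i j) + k ≡ N
    dec-total {i} {k} j total ij≡1+b = suc-injective (trans (cong (_+ k) (Σᶠ-dec i j ij≡1+b)) total)

  lastStep≡firstStep-zero : ∀ N → FirstStepAt N → ∀ cs c' (i : Fin n → ℕ) → Σᶠ n i ≡ suc N →
    lastStep n cs c' i 0 ≡ firstStep n cs c' i 0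
  lastStep≡firstStep-zero N IH cs c' i Σi≡1+N = begin
    lastStep n cs c' i 0
      ≡⟨ +-identityʳ _ ⟩
    Σᶠ n (λ l → sgn (i l) * ((cs l + 0) * A n cs c' (dec i l) 0))
      ≡⟨ Σᶠ-cong (λ l → sgn*-cong (i l) (λ il≡1+b →
           cong ((cs l + 0) *_) (IH cs c' (dec i l) 0 (dec-total l (trans (+-identityʳ _) Σi≡1+N) il≡1+b)))) ⟩
    Σᶠ n (λ l → sgn (i l) * ((cs l + 0) * (S l + z l)))
      ≡⟨ Σᶠ-scaled-distrib-+ n (sgn ∘ i) (λ l → cs l + 0) S z ⟩
    Σᶠ n (λ l → sgn (i l) * ((cs l + 0) * S l)) + Σᶠ n (λ l → sgn (i l) * ((cs l + 0) * z l))
      ≡⟨ cong₂ _+_ (Σᶠ-dec-comm T (A-cong n cs (suc c') 0) i (λ l → cs l + 0) cs)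
                   (Σᶠ-cong (λ l → cong (λ a → sgn (i l) * (a * z l)) (+-identityʳ (cs l)))) ⟩
    Σᶠ n (λ j → sgn (i j) * (cs j * R j)) + Σᶠ n (λ j → sgn (i j) * (cs j * z j))
      ≡⟨ Σᶠ-scaled-distrib-+ n (sgn ∘ i) cs R z ⟨
    Σᶠ n (λ j → sgn (i j) * (cs j * (R j + z j)))
      ≡⟨ Σᶠ-cong (λ j → cong (λ a → sgn (i j) * (cs j * (a + z j))) (+-identityʳ (R j))) ⟨
    Σᶠ n (λ j → sgn (i j) * (cs j * (lastStep n cs (suc c') (dec i j) 0 + z j)))
      ≡⟨ Σᶠ-cong (λ j → cong (λ a → sgn (i j) * (cs j * a)) (A-lastStep n cs (suc c') (dec i j) 0)) ⟨
    firstStep n cs c' i 0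
      ∎
    where
    open ≡-Reasoning
    T : (Fin n → ℕ) → ℕ
    T v = A n cs (suc c') v 0
    S R z : Fin n → ℕ
    S l = Σᶠ n (λ j → sgn (dec i l j) * (cs j * T (dec (dec i l) j)))
    R j = Σᶠ n (λ l → sgn (dec i j l) * ((cs l + 0) * T (dec (dec i j) l)))
    z l = atOrigin (Σᶠ n (dec i l)) 0

  module FirstStepAtSuc (N : ℕ) (IH : FirstStepAt N) (cs : Fin n → ℕ) (c' : ℕ) (i : Fin n → ℕ) (k : ℕ)
                        (total : Σᶠ n i + suc k ≡ suc N) where
    open ≡-Reasoning

    m : ℕ
    m = Σᶠ n i
    A⁺ A° : (Fin n → ℕ) → ℕ → ℕ
    A⁺ = A n (suc ∘ cs) c'
    A° = A n cs (suc c')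
    X W S : Fin n → ℕ
    X l = A⁺ (dec i l) k
    W j = A° (dec i j) k
    S l = Σᶠ n (λ j → sgn (dec i l j) * (cs j * A° (dec (dec i l) j) (suc k)))
    -- Expanding each A once more turns both sides into sums of these five terms.
    z L₁ L₂ L₃ L₄ L₅ : ℕ
    z = atOrigin m k
    L₁ = Σᶠ n (λ l → sgn (i l) * ((cs l + suc k) * (c' * X l)))
    L₂ = Σᶠ n (λ l → sgn (i l) * ((cs l + suc k) * S l))
    L₃ = c' * (sgn k * ((c' + m) * A⁺ i (k ∸ 1)))
    L₄ = Σᶠ n (λ j → sgn (i j) * (cs j * ((c' + m) * W j)))
    L₅ = c' * z

    regroup : ∀ a b c d e → (a + b) + ((c + d) + e) ≡ ((a + c) + e) + (b + d)
    regroup = solve-∀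
    one*-distrib : ∀ a x y z → 1 * (a * (x + y + z)) ≡ a * x + a * y + a * z
    one*-distrib = solve-∀
    move-first : ∀ a s b x → a * (s * (b * x)) ≡ s * (b * (a * x))
    move-first = solve-∀

    lhs₁ : Σᶠ n (λ l → sgn (i l) * ((cs l + suc k) * A n cs c' (dec i l) (suc k))) ≡ L₁ + L₂
    lhs₁ = trans (Σᶠ-cong (λ l → sgn*-cong (i l) (λ il≡1+b → cong ((cs l + suc k) *_) (begin
             A n cs c' (dec i l) (suc k)        ≡⟨ IH cs c' (dec i l) (suc k) (dec-total-suc l il≡1+b) ⟩
             1 * (c' * X l) + S l + 0           ≡⟨ drop-unit (c' * X l) (S l) ⟩
             c' * X l + S l                     ∎))))
           (Σᶠ-scaled-distrib-+ n (sgn ∘ i) (λ l → cs l + suc k) (λ l → c' * X l) S)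
      where
      drop-unit : ∀ x s → 1 * x + s + 0 ≡ x + s
      drop-unit = solve-∀
      dec-total-suc : ∀ l {b} → i l ≡ suc b → Σᶠ n (dec i l) + suc k ≡ N
      dec-total-suc l il≡1+b = suc-injective (trans (cong (_+ suc k) (Σᶠ-dec i l il≡1+b)) total)

    lhs₂ : 1 * ((c' + m) * A n cs c' i k) ≡ (L₃ + L₄) + L₅
    lhs₂ = begin
      1 * ((c' + m) * A n cs c' i k)
        ≡⟨ cong (λ a → 1 * ((c' + m) * a)) (IH cs c' i k (suc-injective (trans (sym (+-suc m k)) total))) ⟩
      1 * ((c' + m) * (sgn k * (c' * A⁺ i (k ∸ 1)) + ΣW + z))
        ≡⟨ one*-distrib (c' + m) _ ΣW z ⟩
      (c' + m) * (sgn k * (c' * A⁺ i (k ∸ 1))) + (c' + m) * ΣW + (c' + m) * z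
        ≡⟨ cong₂ _+_ (cong₂ _+_ (move-c' (c' + m) (sgn k) c' (A⁺ i (k ∸ 1))) ΣW-scaled) origin-term ⟩
      (L₃ + L₄) + L₅
        ∎
      where
      ΣW = Σᶠ n (λ j → sgn (i j) * (cs j * W j))
      move-c' : ∀ a s c x → a * (s * (c * x)) ≡ c * (s * (a * x))
      move-c' = solve-∀
      ΣW-scaled : (c' + m) * ΣW ≡ L₄
      ΣW-scaled = trans (*-distribˡ-Σᶠ n (c' + m) _)
                        (Σᶠ-cong (λ j → move-first (c' + m) (sgn (i j)) (cs j) (W j)))
      origin-term : (c' + m) * z ≡ L₅
      origin-term = trans (*-distribʳ-+ z c' m) (trans (cong (c' * z +_) (m*atOrigin≡0 m k)) (+-identityʳ _))

    rhs₁ : 1 * (c' * A⁺ i k) ≡ (L₁ + L₃) + L₅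
    rhs₁ = begin
      1 * (c' * A⁺ i k)
        ≡⟨ cong (λ a → 1 * (c' * a)) (A-lastStep n (suc ∘ cs) c' i k) ⟩
      1 * (c' * (ΣX + sgn k * ((c' + m) * A⁺ i (k ∸ 1)) + z))
        ≡⟨ one*-distrib c' ΣX _ z ⟩
      c' * ΣX + L₃ + L₅
        ≡⟨ cong (λ a → a + L₃ + L₅) ΣX-scaled ⟩
      (L₁ + L₃) + L₅
        ∎
      where
      ΣX = Σᶠ n (λ l → sgn (i l) * ((suc (cs l) + k) * X l))
      ΣX-scaled : c' * ΣX ≡ L₁
      ΣX-scaled = trans (*-distribˡ-Σᶠ n c' _) (Σᶠ-cong (λ l →
        trans (cong (λ a → c' * (sgn (i l) * (a * X l))) (sym (+-suc (cs l) k)))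
              (move-first c' (sgn (i l)) (cs l + suc k) (X l))))

    rhs₂ : Σᶠ n (λ j → sgn (i j) * (cs j * A° (dec i j) (suc k))) ≡ L₂ + L₄
    rhs₂ = begin
      Σᶠ n (λ j → sgn (i j) * (cs j * A° (dec i j) (suc k)))
        ≡⟨ Σᶠ-cong (λ j → cong (λ a → sgn (i j) * (cs j * a))
             (trans (A-lastStep n cs (suc c') (dec i j) (suc k)) (drop-unit (R j) (Q j * W j)))) ⟩
      Σᶠ n (λ j → sgn (i j) * (cs j * (R j + Q j * W j)))
        ≡⟨ Σᶠ-scaled-distrib-+ n (sgn ∘ i) cs R (λ j → Q j * W j) ⟩
      Σᶠ n (λ j → sgn (i j) * (cs j * R j)) + Σᶠ n (λ j → sgn (i j) * (cs j * (Q j * W j)))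
        ≡⟨ cong₂ _+_ (sym (Σᶠ-dec-comm (λ v → A° v (suc k)) (A-cong n cs (suc c') (suc k)) i (λ l → cs l + suc k) cs))
                     (Σᶠ-cong (λ j → sgn*-cong (i j) (λ ij≡1+b → cong (λ a → cs j * (a * W j)) (Q≡c'+m j ij≡1+b)))) ⟩
      L₂ + L₄
        ∎
      where
      R Q : Fin n → ℕ
      R j = Σᶠ n (λ l → sgn (dec i j l) * ((cs l + suc k) * A° (dec (dec i j) l) (suc k)))
      Q j = suc c' + Σᶠ n (dec i j)
      drop-unit : ∀ r y → r + 1 * y + 0 ≡ r + y
      drop-unit = solve-∀
      Q≡c'+m : ∀ j {b} → i j ≡ suc b → Q j ≡ c' + m
      Q≡c'+m j ij≡1+b = trans (sym (+-suc c' _)) (cong (c' +_) (Σᶠ-dec i j ij≡1+b))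

    lastStep≡firstStep : lastStep n cs c' i (suc k) ≡ firstStep n cs c' i (suc k)
    lastStep≡firstStep = begin
      lastStep n cs c' i (suc k)      ≡⟨ cong₂ _+_ lhs₁ lhs₂ ⟩
      (L₁ + L₂) + ((L₃ + L₄) + L₅)    ≡⟨ regroup L₁ L₂ L₃ L₄ L₅ ⟩
      ((L₁ + L₃) + L₅) + (L₂ + L₄)    ≡⟨ cong₂ _+_ rhs₁ rhs₂ ⟨
      firstStep n cs c' i (suc k)     ∎

  firstStepAt : ∀ N → FirstStepAt N
  firstStepAt zero cs c' i k total = begin
    A n cs c' i k                                   ≡⟨ A-lastStep n cs c' i k ⟩
    lastStep n cs c' i k + atOrigin (Σᶠ n i) k      ≡⟨ cong (_+ atOrigin (Σᶠ n i) k) (trans (lastStep-at-origin n cs c' i k total) (sym firstStep≡0)) ⟩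
    firstStep n cs c' i k + atOrigin (Σᶠ n i) k     ∎
    where
    open ≡-Reasoning
    firstStep≡0 : firstStep n cs c' i k ≡ 0
    firstStep≡0 = cong₂ _+_ (cong (λ v → sgn v * (c' * A n (suc ∘ cs) c' i (k ∸ 1))) (m+n≡0⇒n≡0 (Σᶠ n i) total))
                            (Σᶠ-sgn≡0 n i _ (m+n≡0⇒m≡0 (Σᶠ n i) total))
  firstStepAt (suc N) cs c' i zero total =
    trans (A-lastStep n cs c' i 0)
          (cong (_+ atOrigin (Σᶠ n i) 0) (lastStep≡firstStep-zero N (firstStepAt N) cs c' i (trans (sym (+-identityʳ _)) total)))
  firstStepAt (suc N) cs c' i (suc k) total =
    trans (A-lastStep n cs c' i (suc k))
          (cong (_+ atOrigin (Σᶠ n i) (suc k)) (FirstStepAtSuc.lastStep≡firstStep N (firstStepAt N) cs c' i k total))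

A-firstStep : ∀ n cs c' i k → A n cs c' i k ≡ firstStep n cs c' i k + atOrigin (Σᶠ n i) k
A-firstStep n cs c' i k = firstStepAt n (Σᶠ n i + k) cs c' i k refl

-- Σ over words w of length m with letter counts i of Π_x (cs (w x) + c' + x), by the first letter.
wordSum : (n : ℕ) → (Fin n → ℕ) → ℕ → ℕ → (Fin n → ℕ) → ℕ
wordSum n cs zero    c' i = atOrigin (Σᶠ n i) 0
wordSum n cs (suc m) c' i = Σᶠ n (λ j → sgn (i j) * ((cs j + c') * wordSum n cs m (suc c') (dec i j)))

module _ {X : Set} where

  sum-map-concatMap : ∀ {Y : Set} (h : Y → ℕ) (g : X → List Y) L →
    sum (map h (concatMap g L)) ≡ sum (map (λ x → sum (map h (g x))) L)
  sum-map-concatMap h g []      = refl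
  sum-map-concatMap h g (x ∷ L) = begin
    sum (map h (g x ++ concatMap g L))                    ≡⟨ cong sum (map-++ h (g x) _) ⟩
    sum (map h (g x) ++ map h (concatMap g L))            ≡⟨ sum-++ (map h (g x)) _ ⟩
    sum (map h (g x)) + sum (map h (concatMap g L))       ≡⟨ cong (sum (map h (g x)) +_) (sum-map-concatMap h g L) ⟩
    sum (map h (g x)) + sum (map (λ x → sum (map h (g x))) L) ∎
    where open ≡-Reasoning

  sum-map-Σᶠ : ∀ n (φ : X → Fin n → ℕ) L → sum (map (λ x → Σᶠ n (φ x)) L) ≡ Σᶠ n (λ a → sum (map (λ x → φ x a) L))
  sum-map-Σᶠ n φ []      = sym (Σᶠ-zero n)
  sum-map-Σᶠ n φ (x ∷ L) = trans (cong (Σᶠ n (φ x) +_) (sum-map-Σᶠ n φ L)) (sym (Σᶠ-distrib-+ n (φ x) _))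

  sum-map-* : ∀ c (h : X → ℕ) L → sum (map (λ x → c * h x) L) ≡ c * sum (map h L)
  sum-map-* c h []      = sym (*-zeroʳ c)
  sum-map-* c h (x ∷ L) = trans (cong (c * h x +_) (sum-map-* c h L)) (sym (*-distribˡ-+ c (h x) _))

sum-map-allFins : ∀ n (φ : Fin n → ℕ) → sum (map φ (allFins n)) ≡ Σᶠ n φ
sum-map-allFins zero    φ = refl
sum-map-allFins (suc n) φ =
  cong (φ F.zero +_) (trans (cong sum (sym (map-∘ (allFins n)))) (sum-map-allFins n (φ ∘ F.suc)))

allᶠ-cong : ∀ n {p q : Fin n → Bool} → p ≗ q → allᶠ n p ≡ allᶠ n q
allᶠ-cong zero    p≗q = refl
allᶠ-cong (suc n) p≗q = cong₂ _∧_ (p≗q F.zero) (allᶠ-cong n (p≗q ∘ F.suc))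

allᶠ-false : ∀ n (p : Fin n → Bool) j → p j ≡ false → allᶠ n p ≡ false
allᶠ-false (suc n) p F.zero    pj≡false rewrite pj≡false = refl
allᶠ-false (suc n) p (F.suc j) pj≡false with p F.zero
... | false = refl
... | true  = allᶠ-false n (p ∘ F.suc) j pj≡false

Πᶠ-cong : ∀ m {f g : Fin m → ℕ} → f ≗ g → Πᶠ m f ≡ Πᶠ m g
Πᶠ-cong zero    f≗g = refl
Πᶠ-cong (suc m) f≗g = cong₂ _*_ (f≗g F.zero) (Πᶠ-cong m (f≗g ∘ F.suc))

inF-empty : ∀ n (i : Fin n → ℕ) (f : Fin 0 → Fin n) → (if inF i f then 1 else 0) ≡ atOrigin (Σᶠ n i) 0
inF-empty zero    i f = refl
inF-empty (suc n) i f with i F.zero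
... | zero  = inF-empty n (i ∘ F.suc) (λ ())
... | suc _ = refl

module _ {n : ℕ} (cs : Fin n → ℕ) where

  inF-cons-zero : ∀ {m} (i : Fin n → ℕ) a (f : Fin m → Fin n) → i a ≡ 0 → inF i (consF a f) ≡ false
  inF-cons-zero i a f ia≡0 = allᶠ-false n _ a first-fiber
    where
    first-fiber : (fiber (consF a f) a ≡ᵇ i a) ≡ false
    first-fiber rewrite ia≡0 with a ≟ a
    ... | yes _  = refl
    ... | no a≢a = ⊥-elim (a≢a refl)

  inF-cons-suc : ∀ {m} (i : Fin n → ℕ) a (f : Fin m → Fin n) {b} → i a ≡ suc b → inF i (consF a f) ≡ inF (dec i a) f
  inF-cons-suc i a f ia≡1+b = allᶠ-cong n fibers
    where
    fibers : ∀ j → (fiber (consF a f) j ≡ᵇ i j) ≡ (fiber f j ≡ᵇ dec i a j)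
    fibers j with a ≟ j | j ≟ a
    ... | yes refl | yes _    rewrite ia≡1+b = refl
    ... | yes refl | no j≢a   = ⊥-elim (j≢a refl)
    ... | no a≢j   | yes refl = ⊥-elim (a≢j refl)
    ... | no _     | no _     = refl

  term : ∀ m → ℕ → (Fin n → ℕ) → (Fin m → Fin n) → ℕ
  term m c' i f = if inF i f then Πᶠ m (λ x → cs (f x) + c' + toℕ x) else 0

  term-cons : ∀ m c' (i : Fin n → ℕ) a (f : Fin m → Fin n) →
    term (suc m) c' i (consF a f) ≡ sgn (i a) * ((cs a + c') * term m (suc c') (dec i a) f)
  term-cons m c' i a f = by-count (i a) refl
    where
    by-count : ∀ v → i a ≡ v → term (suc m) c' i (consF a f) ≡ sgn (i a) * ((cs a + c') * term m (suc c') (dec i a) f)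
    by-count zero    ia≡0 rewrite inF-cons-zero i a f ia≡0 | ia≡0 = refl
    by-count (suc b) ia≡1+b = trans first-letter (sym (sgn*-identity ia≡1+b))
      where
      first-letter : term (suc m) c' i (consF a f) ≡ (cs a + c') * term m (suc c') (dec i a) f
      first-letter rewrite inF-cons-suc i a f ia≡1+b with inF (dec i a) f
      ... | true  = cong₂ _*_ (+-identityʳ (cs a + c')) (Πᶠ-cong m (λ x → shift (cs (f x)) c' (toℕ x)))
        where
        shift : ∀ a c t → a + c + suc t ≡ a + suc c + t
        shift = solve-∀
      ... | false = sym (*-zeroʳ (cs a + c'))

  sum-term≡wordSum : ∀ m c' (i : Fin n → ℕ) → sum (map (term m c' i) (allFuns m n)) ≡ wordSum n cs m c' i
  sum-term≡wordSum zero    c' i = trans (+-identityʳ _) (inF-empty n i (λ ()))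
  sum-term≡wordSum (suc m) c' i = begin
    sum (map (term (suc m) c' i) (concatMap (λ f → map (λ a → consF a f) (allFins n)) (allFuns m n)))
      ≡⟨ sum-map-concatMap (term (suc m) c' i) (λ f → map (λ a → consF a f) (allFins n)) (allFuns m n) ⟩
    sum (map (λ f → sum (map (term (suc m) c' i) (map (λ a → consF a f) (allFins n)))) (allFuns m n))
      ≡⟨ cong sum (map-cong (λ f → trans (cong sum (sym (map-∘ (allFins n))))
                                          (sum-map-allFins n (λ a → term (suc m) c' i (consF a f)))) (allFuns m n)) ⟩
    sum (map (λ f → Σᶠ n (λ a → term (suc m) c' i (consF a f))) (allFuns m n))
      ≡⟨ cong sum (map-cong (λ f → Σᶠ-cong (λ a → term-cons m c' i a f)) (allFuns m n)) ⟩
    sum (map (λ f → Σᶠ n (λ a → sgn (i a) * ((cs a + c') * term m (suc c') (dec i a) f))) (allFuns m n))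
      ≡⟨ sum-map-Σᶠ n (λ f a → sgn (i a) * ((cs a + c') * term m (suc c') (dec i a) f)) (allFuns m n) ⟩
    Σᶠ n (λ a → sum (map (λ f → sgn (i a) * ((cs a + c') * term m (suc c') (dec i a) f)) (allFuns m n)))
      ≡⟨ Σᶠ-cong (λ a → trans (sum-map-* (sgn (i a)) _ (allFuns m n))
                               (cong (sgn (i a) *_) (sum-map-* (cs a + c') _ (allFuns m n)))) ⟩
    Σᶠ n (λ a → sgn (i a) * ((cs a + c') * sum (map (term m (suc c') (dec i a)) (allFuns m n))))
      ≡⟨ Σᶠ-cong (λ a → cong (λ s → sgn (i a) * ((cs a + c') * s)) (sum-term≡wordSum m (suc c') (dec i a))) ⟩
    wordSum n cs (suc m) c' i
      ∎
    where open ≡-Reasoning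

sumF≡wordSum : ∀ n cs c' i → sumF n cs c' i ≡ wordSum n cs (Σᶠ n i) c' i
sumF≡wordSum n cs c' i = sum-term≡wordSum cs (Σᶠ n i) c' i

wordSum-cong : ∀ n cs m c' {i i′ : Fin n → ℕ} → i ≗ i′ → wordSum n cs m c' i ≡ wordSum n cs m c' i′
wordSum-cong n cs zero    c' i≗i′ = cong (λ s → atOrigin s 0) (Σᶠ-cong i≗i′)
wordSum-cong n cs (suc m) c' i≗i′ =
  Σᶠ-cong (λ j → cong₂ (λ a w → sgn a * ((cs j + c') * w)) (i≗i′ j) (wordSum-cong n cs m (suc c') (dec-cong i≗i′ j)))

wordSum-shift : ∀ n cs m c' (i : Fin n → ℕ) → wordSum n (suc ∘ cs) m c' i ≡ wordSum n cs m (suc c') i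
wordSum-shift n cs zero    c' i = refl
wordSum-shift n cs (suc m) c' i =
  Σᶠ-cong (λ j → cong₂ (λ a w → sgn (i j) * (a * w)) (sym (+-suc (cs j) c')) (wordSum-shift n cs m (suc c') (dec i j)))

wordSum-lastLetter : ∀ n cs m c' (i : Fin n → ℕ) →
  wordSum n cs (suc m) c' i ≡ Σᶠ n (λ j → sgn (i j) * ((cs j + c' + m) * wordSum n cs m c' (dec i j)))
wordSum-lastLetter n cs zero c' i =
  Σᶠ-cong (λ j → cong (λ a → sgn (i j) * (a * atOrigin (Σᶠ n (dec i j)) 0)) (sym (+-identityʳ (cs j + c'))))
wordSum-lastLetter n cs (suc m) c' i = begin
  Σᶠ n (λ j → sgn (i j) * ((cs j + c') * wordSum n cs (suc m) (suc c') (dec i j)))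
    ≡⟨ Σᶠ-cong (λ j → cong (λ w → sgn (i j) * ((cs j + c') * w)) (wordSum-lastLetter n cs m (suc c') (dec i j))) ⟩
  Σᶠ n (λ j → sgn (i j) * ((cs j + c') * Σᶠ n (λ l → sgn (dec i j l) * ((cs l + suc c' + m) * W (dec (dec i j) l)))))
    ≡⟨ Σᶠ-dec-comm W (wordSum-cong n cs m (suc c')) i (λ j → cs j + c') (λ l → cs l + suc c' + m) ⟩
  Σᶠ n (λ l → sgn (i l) * ((cs l + suc c' + m) * Σᶠ n (λ j → sgn (dec i l j) * ((cs j + c') * W (dec (dec i l) j)))))
    ≡⟨ Σᶠ-cong (λ l → cong (λ a → sgn (i l) * (a * wordSum n cs (suc m) c' (dec i l))) (shift (cs l) c' m)) ⟩
  Σᶠ n (λ l → sgn (i l) * ((cs l + c' + suc m) * wordSum n cs (suc m) c' (dec i l)))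
    ∎
  where
  open ≡-Reasoning
  W : (Fin n → ℕ) → ℕ
  W = wordSum n cs m (suc c')
  shift : ∀ a c m → a + suc c + m ≡ a + c + suc m
  shift = solve-∀

wordSum-weight : ∀ n cs m c' (i : Fin n → ℕ) →
  (c' + m) * wordSum n cs m c' i
  ≡ c' * wordSum n cs m (suc c') i + m * Σᶠ n (λ j → sgn (i j) * (cs j * wordSum n cs (m ∸ 1) (suc c') (dec i j)))
wordSum-weight n cs zero    c' i = trans (cong (_* atOrigin (Σᶠ n i) 0) (+-identityʳ c')) (sym (+-identityʳ _))
wordSum-weight n cs (suc m) c' i = begin
  (c' + suc m) * Σᶠ n (λ j → sgn (i j) * ((cs j + c') * W j))
    ≡⟨ *-distribˡ-Σᶠ n (c' + suc m) _ ⟩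
  Σᶠ n (λ j → (c' + suc m) * (sgn (i j) * ((cs j + c') * W j)))
    ≡⟨ Σᶠ-cong (λ j → split c' m (sgn (i j)) (cs j) (W j)) ⟩
  Σᶠ n (λ j → c' * (sgn (i j) * ((cs j + suc c' + m) * W j)) + suc m * (sgn (i j) * (cs j * W j)))
    ≡⟨ Σᶠ-distrib-+ n _ _ ⟩
  Σᶠ n (λ j → c' * (sgn (i j) * ((cs j + suc c' + m) * W j))) + Σᶠ n (λ j → suc m * (sgn (i j) * (cs j * W j)))
    ≡⟨ cong₂ _+_ (trans (sym (*-distribˡ-Σᶠ n c' _)) (cong (c' *_) (sym (wordSum-lastLetter n cs m (suc c') i))))
                 (sym (*-distribˡ-Σᶠ n (suc m) _)) ⟩
  c' * wordSum n cs (suc m) (suc c') i + suc m * Σᶠ n (λ j → sgn (i j) * (cs j * W j))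
    ∎
  where
  open ≡-Reasoning
  W : Fin n → ℕ
  W j = wordSum n cs m (suc c') (dec i j)
  split : ∀ c m s a w → (c + suc m) * (s * ((a + c) * w)) ≡ c * (s * ((a + suc c + m) * w)) + suc m * (s * (a * w))
  split = solve-∀

Family : ℕ → Set
Family n = (Fin n → ℕ) → ℕ → (Fin n → ℕ) → ℕ → ℕ

FirstStepRec : ∀ {n} → Family n → Set
FirstStepRec {n} X = ∀ cs c' i k →
  X cs c' i (suc k) ≡ c' * X (suc ∘ cs) c' i k + Σᶠ n i * Σᶠ n (λ j → sgn (i j) * (cs j * X cs (suc c') (dec i j) (suc k)))

scaledA : (n : ℕ) → Family n
scaledA n cs c' i k = Σᶠ n i ! * A n cs c' i k

predictedA : (n : ℕ) → Family n
predictedA n cs c' i k = (c' + Σᶠ n i) ^ (Σᶠ n i + k) * wordSum n cs (Σᶠ n i) c' i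

scaledA-rec : ∀ n → FirstStepRec (scaledA n)
scaledA-rec n cs c' i k = begin
  m ! * A n cs c' i (suc k)
    ≡⟨ cong (m ! *_) (trans (A-firstStep n cs c' i (suc k)) (+-identityʳ _)) ⟩
  m ! * (1 * (c' * A n (suc ∘ cs) c' i k) + ΣJ)
    ≡⟨ pull-c' (m !) c' (A n (suc ∘ cs) c' i k) ΣJ ⟩
  c' * (m ! * A n (suc ∘ cs) c' i k) + m ! * ΣJ
    ≡⟨ cong (c' * (m ! * A n (suc ∘ cs) c' i k) +_) (trans (*-distribˡ-Σᶠ n (m !) _) (trans
         (Σᶠ-cong (λ j → trans (move (m !) (sgn (i j)) (cs j) (A° j))
                               (sgn*-cong (i j) (λ ij≡1+b → cong (λ f → cs j * (f * A° j)) (m!≡m*[m-1]! j ij≡1+b)))))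
         (trans (Σᶠ-cong (λ j → pull-m m (sgn (i j)) (cs j) (Σᶠ n (dec i j) !) (A° j)))
                (sym (*-distribˡ-Σᶠ n m _))))) ⟩
  c' * (m ! * A n (suc ∘ cs) c' i k) + m * Σᶠ n (λ j → sgn (i j) * (cs j * (Σᶠ n (dec i j) ! * A° j)))
    ∎
  where
  open ≡-Reasoning
  m = Σᶠ n i
  A° : Fin n → ℕ
  A° j = A n cs (suc c') (dec i j) (suc k)
  ΣJ = Σᶠ n (λ j → sgn (i j) * (cs j * A° j))
  pull-c' : ∀ f c a s → f * (1 * (c * a) + s) ≡ c * (f * a) + f * s
  pull-c' = solve-∀
  move : ∀ f s c x → f * (s * (c * x)) ≡ s * (c * (f * x))
  move = solve-∀
  pull-m : ∀ m s c f x → s * (c * (m * f * x)) ≡ m * (s * (c * (f * x)))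
  pull-m = solve-∀
  m!≡m*[m-1]! : ∀ j {b} → i j ≡ suc b → m ! ≡ m * Σᶠ n (dec i j) !
  m!≡m*[m-1]! j ij≡1+b = trans (cong _! (sym (Σᶠ-dec i j ij≡1+b))) (cong (_* Σᶠ n (dec i j) !) (Σᶠ-dec i j ij≡1+b))

predictedA-rec : ∀ n → FirstStepRec (predictedA n)
predictedA-rec n cs c' i k = begin
  s ^ (m + suc k) * W
    ≡⟨ cong (λ e → s ^ e * W) (+-suc m k) ⟩
  s * s ^ (m + k) * W
    ≡⟨ trans (*-assoc s _ W) (trans (cong (s *_) (*-comm (s ^ (m + k)) W)) (sym (*-assoc s W _))) ⟩
  s * W * s ^ (m + k)
    ≡⟨ cong (_* s ^ (m + k)) (wordSum-weight n cs m c' i) ⟩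
  (c' * W⁺ + m * ΣW) * s ^ (m + k)
    ≡⟨ distrib c' W⁺ m ΣW (s ^ (m + k)) ⟩
  c' * (s ^ (m + k) * W⁺) + m * (s ^ (m + k) * ΣW)
    ≡⟨ cong₂ (λ w t → c' * (s ^ (m + k) * w) + m * t) (sym (wordSum-shift n cs m c' i)) inner ⟩
  c' * predictedA n (suc ∘ cs) c' i k + m * Σᶠ n (λ j → sgn (i j) * (cs j * predictedA n cs (suc c') (dec i j) (suc k)))
    ∎
  where
  open ≡-Reasoning
  m = Σᶠ n i
  s = c' + m
  W = wordSum n cs m c' i
  W⁺ = wordSum n cs m (suc c') i
  ΣW = Σᶠ n (λ j → sgn (i j) * (cs j * wordSum n cs (m ∸ 1) (suc c') (dec i j)))
  distrib : ∀ c w m t x → (c * w + m * t) * x ≡ c * (x * w) + m * (x * t)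
  distrib = solve-∀
  move : ∀ x a b r → x * (a * (b * r)) ≡ a * (b * (x * r))
  move = solve-∀
  at-dec : ∀ j {b} → i j ≡ suc b →
    s ^ (m + k) * wordSum n cs (m ∸ 1) (suc c') (dec i j) ≡ predictedA n cs (suc c') (dec i j) (suc k)
  at-dec j ij≡1+b = begin
    s ^ (m + k) * wordSum n cs (m ∸ 1) (suc c') (dec i j)
      ≡⟨ cong (λ t → (c' + t) ^ (t + k) * wordSum n cs (t ∸ 1) (suc c') (dec i j)) (sym (Σᶠ-dec i j ij≡1+b)) ⟩
    (c' + suc m′) ^ (suc m′ + k) * wordSum n cs m′ (suc c') (dec i j)
      ≡⟨ cong₂ (λ a e → a ^ e * wordSum n cs m′ (suc c') (dec i j)) (+-suc c' m′) (sym (+-suc m′ k)) ⟩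
    predictedA n cs (suc c') (dec i j) (suc k)
      ∎
    where m′ = Σᶠ n (dec i j)
  inner : s ^ (m + k) * ΣW ≡ Σᶠ n (λ j → sgn (i j) * (cs j * predictedA n cs (suc c') (dec i j) (suc k)))
  inner = trans (*-distribˡ-Σᶠ n (s ^ (m + k)) _)
    (Σᶠ-cong (λ j → trans (move (s ^ (m + k)) (sgn (i j)) (cs j) _)
                          (sgn*-cong (i j) (λ ij≡1+b → cong (cs j *_) (at-dec j ij≡1+b)))))

dist-+ : ∀ a b c d → dist (a + b) (c + d) ≤ dist a c + dist b d
dist-+ a b c d = begin
  dist (a + b) (c + d)                          ≤⟨ ∣-∣-triangle (a + b) (c + b) (c + d) ⟩
  dist (a + b) (c + b) + dist (c + b) (c + d)   ≡⟨ cong₂ _+_ (cong₂ dist (+-comm a b) (+-comm c b)) (∣m+n-m+o∣≡∣n-o∣ c b d) ⟩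
  dist (b + a) (b + c) + dist b d               ≡⟨ cong (_+ dist b d) (∣m+n-m+o∣≡∣n-o∣ b a c) ⟩
  dist a c + dist b d                           ∎
  where open ≤-Reasoning

dist-Σᶠ : ∀ n (f g : Fin n → ℕ) → dist (Σᶠ n f) (Σᶠ n g) ≤ Σᶠ n (λ x → dist (f x) (g x))
dist-Σᶠ zero    f g = z≤n
dist-Σᶠ (suc n) f g =
  ≤-trans (dist-+ (f F.zero) _ (g F.zero) _) (+-monoʳ-≤ (dist (f F.zero) (g F.zero)) (dist-Σᶠ n (f ∘ F.suc) (g ∘ F.suc)))

*-*-distribˡ-dist : ∀ a b x y → dist (a * (b * x)) (a * (b * y)) ≡ a * (b * dist x y)
*-*-distribˡ-dist a b x y =
  sym (trans (cong (a *_) (*-distribˡ-∣-∣ b x y)) (*-distribˡ-∣-∣ a (b * x) (b * y)))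

module _ {n : ℕ} {X Y : Family n} (X-rec : FirstStepRec X) (Y-rec : FirstStepRec Y) where

  Dist : Family n
  Dist cs c' i k = dist (X cs c' i k) (Y cs c' i k)

  Dist-rec : ∀ cs c' i k → Dist cs c' i (suc k) ≤
    c' * Dist (suc ∘ cs) c' i k + Σᶠ n i * Σᶠ n (λ j → sgn (i j) * (cs j * Dist cs (suc c') (dec i j) (suc k)))
  Dist-rec cs c' i k = begin
    dist (X cs c' i (suc k)) (Y cs c' i (suc k))
      ≡⟨ cong₂ dist (X-rec cs c' i k) (Y-rec cs c' i k) ⟩
    dist (c' * X (suc ∘ cs) c' i k + m * ΣX) (c' * Y (suc ∘ cs) c' i k + m * ΣY)
      ≤⟨ dist-+ (c' * X (suc ∘ cs) c' i k) (m * ΣX) (c' * Y (suc ∘ cs) c' i k) (m * ΣY) ⟩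
    dist (c' * X (suc ∘ cs) c' i k) (c' * Y (suc ∘ cs) c' i k) + dist (m * ΣX) (m * ΣY)
      ≡⟨ cong₂ _+_ (sym (*-distribˡ-∣-∣ c' _ _)) (sym (*-distribˡ-∣-∣ m ΣX ΣY)) ⟩
    c' * Dist (suc ∘ cs) c' i k + m * dist ΣX ΣY
      ≤⟨ +-monoʳ-≤ (c' * Dist (suc ∘ cs) c' i k) (*-monoʳ-≤ m (dist-Σᶠ n _ _)) ⟩
    c' * Dist (suc ∘ cs) c' i k + m * Σᶠ n (λ j → dist (sgn (i j) * (cs j * X° j)) (sgn (i j) * (cs j * Y° j)))
      ≡⟨ cong (λ t → c' * Dist (suc ∘ cs) c' i k + m * t) (Σᶠ-cong (λ j → *-*-distribˡ-dist (sgn (i j)) (cs j) (X° j) (Y° j))) ⟩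
    c' * Dist (suc ∘ cs) c' i k + m * Σᶠ n (λ j → sgn (i j) * (cs j * Dist cs (suc c') (dec i j) (suc k)))
      ∎
    where
    open ≤-Reasoning
    m = Σᶠ n i
    X° Y° : Fin n → ℕ
    X° j = X cs (suc c') (dec i j) (suc k)
    Y° j = Y cs (suc c') (dec i j) (suc k)
    ΣX = Σᶠ n (λ j → sgn (i j) * (cs j * X° j))
    ΣY = Σᶠ n (λ j → sgn (i j) * (cs j * Y° j))

  module _ (agree : ∀ cs c' i k → Σᶠ n i ≡ 0 → X cs c' i k ≡ Y cs c' i k)
           (initial : ∀ c' i → Σ ℕ λ C → Σ ℕ λ D → ∀ M cs → (∀ j → cs j ≤ M) → Dist cs c' i 0 ≤ C * suc M ^ D)
           where

    DistBound : ℕ → ℕ → (Fin n → ℕ) → ℕ → ℕ → Set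
    DistBound p c' i C D = ∀ M cs k → (∀ j → cs j ≤ M) → Dist cs c' i k ≤ C * suc (M + k) ^ D * p ^ k

    DistBound-mono : ∀ {p c' i C C′ D D′} → C ≤ C′ → D ≤ D′ → DistBound p c' i C D → DistBound p c' i C′ D′
    DistBound-mono {p} C≤C′ D≤D′ bound M cs k cs≤M =
      ≤-trans (bound M cs k cs≤M) (*-monoˡ-≤ (p ^ k) (*-mono-≤ C≤C′ (^-monoʳ-≤ (suc (M + k)) D≤D′)))

    -- The recursion raises every c_j, so the induction on k must be uniform over all cs ≤ M.
    module InductionStep (m c' : ℕ) (i : Fin n → ℕ) (Σi≡1+m : Σᶠ n i ≡ suc m) (C′ D′ : ℕ)
                         (dec-bound : ∀ j {b} → i j ≡ suc b → DistBound (c' + m) (suc c') (dec i j) C′ D′) where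
      p C₀ D₀ K : ℕ
      p = c' + m
      C₀ = proj₁ (initial c' i)
      D₀ = proj₁ (proj₂ (initial c' i))
      K = suc m * (n * C′)

      -- each step in k adds one term K (1 + M + k)^(D′ + 1)
      bnd : ℕ → ℕ → ℕ
      bnd M k = C₀ * suc (M + k) ^ D₀ + k * (K * suc (M + k) ^ suc D′)
      claim : ∀ k M cs → (∀ j → cs j ≤ M) → Dist cs c' i k ≤ bnd M k * p ^ k
      claim zero    M cs cs≤M = begin
        Dist cs c' i 0                      ≤⟨ proj₂ (proj₂ (initial c' i)) M cs cs≤M ⟩
        C₀ * suc M ^ D₀                     ≡⟨ pad C₀ (suc M ^ D₀) ⟩
        (C₀ * suc M ^ D₀ + 0) * 1           ≡⟨ cong (λ t → (C₀ * suc t ^ D₀ + 0) * 1) (+-identityʳ M) ⟨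
        bnd M 0 * p ^ 0                     ∎
        where
        open ≤-Reasoning
        pad : ∀ c x → c * x ≡ (c * x + 0) * 1
        pad = solve-∀
      claim (suc k) M cs cs≤M = begin
        Dist cs c' i (suc k)
          ≤⟨ Dist-rec cs c' i k ⟩
        c' * Dist (suc ∘ cs) c' i k + Σᶠ n i * Σᶠ n (λ j → sgn (i j) * (cs j * Dist cs (suc c') (dec i j) (suc k)))
          ≤⟨ +-mono-≤ (*-monoʳ-≤ c' (claim k (suc M) (suc ∘ cs) (s≤s ∘ cs≤M)))
                      (*-mono-≤ (≤-reflexive Σi≡1+m) (Σᶠ-≤-* n (M * E) (λ j → ≤-trans
                         (sgn*-mono-≤ (i j) (λ ij≡1+b → *-monoʳ-≤ (cs j) (dec-bound j ij≡1+b M cs (suc k) cs≤M)))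
                         (≤-trans (sgn*≤ (i j) _) (*-monoˡ-≤ E (cs≤M j)))))) ⟩
        c' * (bnd (suc M) k * p ^ k) + suc m * (n * (M * E))
          ≤⟨ +-mono-≤ (≤-reflexive (*-comm c' _)) (≤-reflexive (collect (suc m) n M C′ (b ^ D′) (p ^ suc k))) ⟩
        bnd (suc M) k * p ^ k * c' + K * (M * b ^ D′) * p ^ suc k
          ≤⟨ +-mono-≤ (≤-trans (*-monoʳ-≤ (bnd (suc M) k * p ^ k) (m≤m+n c' m)) (≤-reflexive (*-assoc (bnd (suc M) k) (p ^ k) p)))
                      (*-monoˡ-≤ (p ^ suc k) (*-monoʳ-≤ K (*-monoˡ-≤ (b ^ D′) (≤-trans (m≤m+n M (suc k)) (n≤1+n _))))) ⟩
        bnd (suc M) k * (p ^ k * p) + K * (b * b ^ D′) * p ^ suc k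
          ≡⟨ cong₂ _+_ (cong (bnd (suc M) k *_) (*-comm (p ^ k) p)) refl ⟩
        bnd (suc M) k * p ^ suc k + K * b ^ suc D′ * p ^ suc k
          ≡⟨ next-bnd ⟩
        bnd M (suc k) * p ^ suc k
          ∎
        where
        open ≤-Reasoning
        b = suc (M + suc k)
        E = C′ * b ^ D′ * p ^ suc k
        collect : ∀ m n M C B P → m * (n * (M * (C * B * P))) ≡ m * (n * C) * (M * B) * P
        collect = solve-∀
        next-bnd : bnd (suc M) k * p ^ suc k + K * b ^ suc D′ * p ^ suc k ≡ bnd M (suc k) * p ^ suc k
        next-bnd = trans (cong (λ t → (C₀ * suc t ^ D₀ + k * (K * suc t ^ suc D′)) * p ^ suc k + K * b ^ suc D′ * p ^ suc k) (sym (+-suc M k)))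
                         (one-more C₀ (b ^ D₀) k K (b ^ suc D′) (p ^ suc k))
          where
          one-more : ∀ C A k K B P → (C * A + k * (K * B)) * P + K * B * P ≡ (C * A + suc k * (K * B)) * P
          one-more = solve-∀
      C D : ℕ
      C = C₀ + K
      D = D₀ + suc (suc D′)

      bound : DistBound (c' + suc m ∸ 1) c' i C D
      bound M cs k cs≤M = begin
        Dist cs c' i k                        ≤⟨ claim k M cs cs≤M ⟩
        bnd M k * p ^ k                       ≤⟨ *-monoˡ-≤ (p ^ k) (+-mono-≤ first second) ⟩
        (C₀ * b ^ Dt + K * b ^ Dt) * p ^ k    ≡⟨ cong₂ _*_ (sym (*-distribʳ-+ (b ^ Dt) C₀ K)) (cong (λ q → (q ∸ 1) ^ k) (sym (+-suc c' m))) ⟩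
        (C₀ + K) * b ^ Dt * (c' + suc m ∸ 1) ^ k ∎
        where
        open ≤-Reasoning
        b = suc (M + k)
        Dt = D₀ + suc (suc D′)
        first : C₀ * b ^ D₀ ≤ C₀ * b ^ Dt
        first = *-monoʳ-≤ C₀ (^-monoʳ-≤ b (m≤m+n D₀ _))
        second : k * (K * b ^ suc D′) ≤ K * b ^ Dt
        second = begin
          k * (K * b ^ suc D′)    ≤⟨ *-monoˡ-≤ (K * b ^ suc D′) (≤-trans (m≤n+m k M) (n≤1+n _)) ⟩
          b * (K * b ^ suc D′)    ≡⟨ x*[K*y]≡K*[x*y] b K (b ^ suc D′) ⟩
          K * b ^ suc (suc D′)    ≤⟨ *-monoʳ-≤ K (^-monoʳ-≤ b (m≤n+m (suc (suc D′)) D₀)) ⟩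
          K * b ^ Dt              ∎
          where
          x*[K*y]≡K*[x*y] : ∀ x K y → x * (K * y) ≡ K * (x * y)
          x*[K*y]≡K*[x*y] = solve-∀

    dist-bound : ∀ m c' i → Σᶠ n i ≡ m → Σ ℕ λ C → Σ ℕ λ D → DistBound (c' + m ∸ 1) c' i C D
    dist-bound zero    c' i Σi≡0   = 0 , 0 , λ M cs k _ → ≤-reflexive (m≡n⇒∣m-n∣≡0 (agree cs c' i k Σi≡0))
    dist-bound (suc m) c' i Σi≡1+m = Step.C , Step.D , Step.bound
      where
      at-dec : ∀ j v → i j ≡ v → Σ ℕ λ C → Σ ℕ λ D → ∀ {b} → i j ≡ suc b → DistBound (c' + m) (suc c') (dec i j) C D
      at-dec j zero    ij≡0   = 0 , 0 , λ ij≡1+b → ⊥-elim (0≢1+n (trans (sym ij≡0) ij≡1+b))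
      at-dec j (suc b) ij≡1+b =
        let C , D , bound = dist-bound m (suc c') (dec i j) (suc-injective (trans (Σᶠ-dec i j ij≡1+b) Σi≡1+m))
        in C , D , λ _ → bound
      C′ D′ : ℕ
      C′ = Σᶠ n (λ j → proj₁ (at-dec j (i j) refl))
      D′ = Σᶠ n (λ j → proj₁ (proj₂ (at-dec j (i j) refl)))
      dec-bound : ∀ j {b} → i j ≡ suc b → DistBound (c' + m) (suc c') (dec i j) C′ D′
      dec-bound j ij≡1+b = DistBound-mono (f≤Σᶠ n _ j) (f≤Σᶠ n _ j) (proj₂ (proj₂ (at-dec j (i j) refl)) ij≡1+b)
      module Step = InductionStep m c' i Σi≡1+m C′ D′ dec-bound

A-at-empty : ∀ n cs c' (i : Fin n → ℕ) k → Σᶠ n i ≡ 0 → A n cs c' i k ≡ c' ^ k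
A-at-empty n cs c' i zero    Σi≡0 =
  trans (A-firstStep n cs c' i 0) (cong₂ _+_ (Σᶠ-sgn≡0 n i _ Σi≡0) (cong (λ s → atOrigin s 0) Σi≡0))
A-at-empty n cs c' i (suc k) Σi≡0 = begin
  A n cs c' i (suc k)
    ≡⟨ trans (A-firstStep n cs c' i (suc k)) (+-identityʳ _) ⟩
  1 * (c' * A n (suc ∘ cs) c' i k) + Σᶠ n (λ j → sgn (i j) * (cs j * A n cs (suc c') (dec i j) (suc k)))
    ≡⟨ cong₂ _+_ (trans (*-identityˡ _) (cong (c' *_) (A-at-empty n (suc ∘ cs) c' i k Σi≡0))) (Σᶠ-sgn≡0 n i _ Σi≡0) ⟩
  c' ^ suc k + 0
    ≡⟨ +-identityʳ _ ⟩
  c' ^ suc k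
    ∎
  where open ≡-Reasoning

A-at-zero-≤ : ∀ n cs M m c' (i : Fin n → ℕ) → Σᶠ n i ≡ m → (∀ j → cs j ≤ M) → A n cs c' i 0 ≤ (n * M) ^ m
A-at-zero-≤ n cs M zero c' i Σi≡0 cs≤M = ≤-reflexive (A-at-empty n cs c' i 0 Σi≡0)
A-at-zero-≤ n cs M (suc m) c' i Σi≡1+m cs≤M = begin
  A n cs c' i 0
    ≡⟨ trans (A-firstStep n cs c' i 0) (trans (cong (λ s → firstStep n cs c' i 0 + atOrigin s 0) Σi≡1+m) (+-identityʳ _)) ⟩
  Σᶠ n (λ j → sgn (i j) * (cs j * A n cs (suc c') (dec i j) 0))
    ≤⟨ Σᶠ-≤-* n (M * (n * M) ^ m) (λ j → ≤-trans (sgn*-mono-≤ (i j) (λ ij≡1+b →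
         *-mono-≤ (cs≤M j) (A-at-zero-≤ n cs M m (suc c') (dec i j) (suc-injective (trans (Σᶠ-dec i j ij≡1+b) Σi≡1+m)) cs≤M)))
         (sgn*≤ (i j) _)) ⟩
  n * (M * (n * M) ^ m)
    ≡⟨ sym (*-assoc n M _) ⟩
  (n * M) ^ suc m
    ∎
  where open ≤-Reasoning

wordSum-≤ : ∀ n cs M m c' (i : Fin n → ℕ) → Σᶠ n i ≡ m → (∀ j → cs j ≤ M) → wordSum n cs m c' i ≤ (n * (M + c' + m)) ^ m
wordSum-≤ n cs M zero    c' i Σi≡0   cs≤M = atOrigin≤1 (Σᶠ n i) 0
wordSum-≤ n cs M (suc m) c' i Σi≡1+m cs≤M = begin
  Σᶠ n (λ j → sgn (i j) * ((cs j + c') * wordSum n cs m (suc c') (dec i j)))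
    ≤⟨ Σᶠ-≤-* n (B * (n * B) ^ m) (λ j → ≤-trans (sgn*-mono-≤ (i j) (λ ij≡1+b →
         *-mono-≤ (≤-trans (+-monoˡ-≤ c' (cs≤M j)) (m≤m+n (M + c') (suc m)))
                  (≤-trans (wordSum-≤ n cs M m (suc c') (dec i j) (suc-injective (trans (Σᶠ-dec i j ij≡1+b) Σi≡1+m)) cs≤M)
                           (≤-reflexive (cong (λ t → (n * t) ^ m) (shift M c' m))))))
         (sgn*≤ (i j) _)) ⟩
  n * (B * (n * B) ^ m)
    ≡⟨ sym (*-assoc n B _) ⟩
  (n * B) ^ suc m
    ∎
  where
  open ≤-Reasoning
  B = M + c' + suc m
  shift : ∀ M c m → M + suc c + m ≡ M + c + suc m
  shift = solve-∀

scaledA≡predictedA-at-empty : ∀ n cs c' (i : Fin n → ℕ) k → Σᶠ n i ≡ 0 → scaledA n cs c' i k ≡ predictedA n cs c' i k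
scaledA≡predictedA-at-empty n cs c' i k Σi≡0 = begin
  Σᶠ n i ! * A n cs c' i k                                       ≡⟨ cong₂ (λ s a → s ! * a) Σi≡0 (A-at-empty n cs c' i k Σi≡0) ⟩
  1 * c' ^ k                                                     ≡⟨ *-identityˡ _ ⟩
  c' ^ k                                                         ≡⟨ cong (λ c → c ^ k) (+-identityʳ c') ⟨
  (c' + 0) ^ k                                                   ≡⟨ *-identityʳ _ ⟨
  (c' + 0) ^ (0 + k) * atOrigin 0 0                              ≡⟨ cong (λ s → (c' + 0) ^ (0 + k) * atOrigin s 0) Σi≡0 ⟨
  (c' + 0) ^ (0 + k) * wordSum n cs 0 c' i                       ≡⟨ cong (λ s → (c' + s) ^ (s + k) * wordSum n cs s c' i) Σi≡0 ⟨
  predictedA n cs c' i k                                         ∎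
  where open ≡-Reasoning

scaledA-predictedA-at-zero : ∀ n c' (i : Fin n → ℕ) → Σ ℕ λ C → Σ ℕ λ D → ∀ M cs → (∀ j → cs j ≤ M) →
  dist (scaledA n cs c' i 0) (predictedA n cs c' i 0) ≤ C * suc M ^ D
scaledA-predictedA-at-zero n c' i = (m ! + s ^ (m + 0)) * (n * suc s) ^ m , m , bound
  where
  m = Σᶠ n i
  s = c' + m
  bound : ∀ M cs → (∀ j → cs j ≤ M) → dist (scaledA n cs c' i 0) (predictedA n cs c' i 0) ≤ (m ! + s ^ (m + 0)) * (n * suc s) ^ m * suc M ^ m
  bound M cs cs≤M = begin
    dist (scaledA n cs c' i 0) (predictedA n cs c' i 0)
      ≤⟨ ≤-trans (∣m-n∣≤m⊔n (scaledA n cs c' i 0) (predictedA n cs c' i 0)) (m⊔n≤m+n (scaledA n cs c' i 0) (predictedA n cs c' i 0)) ⟩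
    m ! * A n cs c' i 0 + s ^ (m + 0) * wordSum n cs m c' i
      ≤⟨ +-mono-≤ (*-monoʳ-≤ (m !) (≤-trans (A-at-zero-≤ n cs M m c' i refl cs≤M) (^-monoˡ-≤ m (*-monoʳ-≤ n M≤B))))
                  (*-monoʳ-≤ (s ^ (m + 0)) (≤-trans (wordSum-≤ n cs M m c' i refl cs≤M) (≤-reflexive (cong (λ t → (n * t) ^ m) (+-assoc M c' m))))) ⟩
    m ! * (n * (M + s)) ^ m + s ^ (m + 0) * (n * (M + s)) ^ m
      ≡⟨ *-distribʳ-+ ((n * (M + s)) ^ m) (m !) (s ^ (m + 0)) ⟨
    (m ! + s ^ (m + 0)) * (n * (M + s)) ^ m
      ≤⟨ *-monoʳ-≤ (m ! + s ^ (m + 0)) (^-monoˡ-≤ m (*-monoʳ-≤ n (M+s≤[1+s]*[1+M] M s))) ⟩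
    (m ! + s ^ (m + 0)) * (n * (suc s * suc M)) ^ m
      ≡⟨ cong ((m ! + s ^ (m + 0)) *_) (trans (cong (_^ m) (sym (*-assoc n (suc s) (suc M)))) (*-^-distrib (n * suc s) (suc M) m)) ⟩
    (m ! + s ^ (m + 0)) * ((n * suc s) ^ m * suc M ^ m)
      ≡⟨ *-assoc (m ! + s ^ (m + 0)) _ _ ⟨
    (m ! + s ^ (m + 0)) * (n * suc s) ^ m * suc M ^ m
      ∎
    where
    open ≤-Reasoning
    M≤B : M ≤ M + s
    M≤B = m≤m+n M s
    M+s≤[1+s]*[1+M] : ∀ M s → M + s ≤ suc s * suc M
    M+s≤[1+s]*[1+M] M s = ≤-trans (m≤m+n (M + s) (s * M + 1)) (≤-reflexive (expand M s))
      where
      expand : ∀ M s → M + s + (s * M + 1) ≡ suc s * suc M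
      expand = solve-∀

predictedA≡sumF-form : ∀ n cs c' (i : Fin n → ℕ) k →
  predictedA n cs c' i k ≡ (c' + Σᶠ n i) ^ Σᶠ n i * sumF n cs c' i * (c' + Σᶠ n i) ^ k
predictedA≡sumF-form n cs c' i k = begin
  s ^ (m + k) * W                    ≡⟨ cong (_* W) (^-distribˡ-+-* s m k) ⟩
  s ^ m * s ^ k * W                  ≡⟨ *-assoc (s ^ m) (s ^ k) W ⟩
  s ^ m * (s ^ k * W)                ≡⟨ cong (s ^ m *_) (*-comm (s ^ k) W) ⟩
  s ^ m * (W * s ^ k)                ≡⟨ *-assoc (s ^ m) W (s ^ k) ⟨
  s ^ m * W * s ^ k                  ≡⟨ cong (λ w → s ^ m * w * s ^ k) (sumF≡wordSum n cs c' i) ⟨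
  s ^ m * sumF n cs c' i * s ^ k     ∎
  where
  open ≡-Reasoning
  m = Σᶠ n i
  s = c' + m
  W = wordSum n cs m c' i

A-estimate : ∀ n cs c' (i : Fin n → ℕ) → Σ ℕ λ C → Σ ℕ λ D → ∀ k →
  dist (A n cs c' i k * Σᶠ n i !) ((c' + Σᶠ n i) ^ Σᶠ n i * sumF n cs c' i * (c' + Σᶠ n i) ^ k)
  ≤ C * suc (Σᶠ n cs + k) ^ D * (c' + Σᶠ n i ∸ 1) ^ k
A-estimate n cs c' i
  with dist-bound (scaledA-rec n) (predictedA-rec n) (scaledA≡predictedA-at-empty n) (scaledA-predictedA-at-zero n) (Σᶠ n i) c' i refl
... | C , D , bound = C , D , λ k →
  subst₂ (λ x y → dist x y ≤ C * suc (Σᶠ n cs + k) ^ D * (c' + Σᶠ n i ∸ 1) ^ k)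
         (*-comm (Σᶠ n i !) (A n cs c' i k)) (predictedA≡sumF-form n cs c' i k)
         (bound (Σᶠ n cs) cs k (f≤Σᶠ n cs))

bernoulli : ∀ p t → p ^ t * (p + t) ≤ p * suc p ^ t
bernoulli p zero    = ≤-reflexive (base p)
  where
  base : ∀ p → 1 * (p + 0) ≡ p * 1
  base = solve-∀
bernoulli p (suc t) = begin
  p ^ suc t * (p + suc t)                 ≡⟨ split p (p ^ t) t ⟩
  p * (p ^ t * (p + t)) + p * p ^ t       ≤⟨ +-mono-≤ (*-monoʳ-≤ p (bernoulli p t)) (*-monoʳ-≤ p (^-monoˡ-≤ t (n≤1+n p))) ⟩
  p * (p * suc p ^ t) + p * suc p ^ t     ≡⟨ join p (suc p ^ t) ⟩
  p * suc p ^ suc t                       ∎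
  where
  open ≤-Reasoning
  split : ∀ p x t → p * x * (p + suc t) ≡ p * (x * (p + t)) + p * x
  split = solve-∀
  join : ∀ p y → p * (p * y) + p * y ≡ p * ((1 + p) * y)
  join = solve-∀

exp-dominates-poly : ∀ Z a D p → Σ ℕ λ N → ∀ k → N ≤ k → Z * suc (a + k) ^ D * p ^ k < suc p ^ k
exp-dominates-poly Z a D zero = 1 , small-base
  where
  small-base : ∀ k → 1 ≤ k → Z * suc (a + k) ^ D * 0 ^ k < 1 ^ k
  small-base (suc k) _ = ≤-reflexive (trans (cong suc (*-zeroʳ (Z * suc (a + suc k) ^ D))) (sym (^-zeroˡ (suc k))))
-- Write k = r + t j with j = D + 1; Bernoulli's inequality raised to the j-th power gives
-- t^j p^k ≤ p^j (p + 1)^k, and t^j eventually beats the polynomial factor.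
exp-dominates-poly Z a D p@(suc _) = suc W * j , beyond
  where
  j = suc D
  G = a + j + j
  W = Z * G ^ D * p ^ j
  beyond : ∀ k → suc W * j ≤ k → Z * suc (a + k) ^ D * p ^ k < suc p ^ k
  beyond k N≤k = *-cancelˡ-< (p ^ j) _ _ (begin-strict
    p ^ j * (Z * suc (a + k) ^ D * p ^ k)   ≤⟨ *-monoʳ-≤ (p ^ j) (*-monoˡ-≤ (p ^ k) (*-monoʳ-≤ Z (^-monoˡ-≤ D 1+a+k≤G*t))) ⟩
    p ^ j * (Z * (G * t) ^ D * p ^ k)       ≡⟨ cong (λ x → p ^ j * (Z * x * p ^ k)) (*-^-distrib G t D) ⟩
    p ^ j * (Z * (G ^ D * t ^ D) * p ^ k)   ≡⟨ regroup (p ^ j) Z (G ^ D) (t ^ D) (p ^ k) ⟩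
    W * X                                   <⟨ *-monoˡ-< X ⦃ >-nonZero X>0 ⦄ W<t ⟩
    t * X                                   ≡⟨ *-assoc t (t ^ D) (p ^ k) ⟨
    t ^ j * p ^ k                           ≤⟨ *-monoˡ-≤ (p ^ k) (^-monoˡ-≤ j (m≤n+m t p)) ⟩
    (p + t) ^ j * p ^ k                     ≡⟨ cong ((p + t) ^ j *_) (pow-split p) ⟩
    (p + t) ^ j * (p ^ r * (p ^ t) ^ j)     ≡⟨ collect (p + t) (p ^ t) (p ^ r) ⟩
    (p ^ t * (p + t)) ^ j * p ^ r           ≤⟨ *-mono-≤ (^-monoˡ-≤ j (bernoulli p t)) (^-monoˡ-≤ r (n≤1+n p)) ⟩
    (p * suc p ^ t) ^ j * suc p ^ r         ≡⟨ spread p (suc p ^ t) (suc p ^ r) ⟩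
    p ^ j * (suc p ^ r * (suc p ^ t) ^ j)   ≡⟨ cong (p ^ j *_) (pow-split (suc p)) ⟨
    p ^ j * suc p ^ k                       ∎)
    where
    open ≤-Reasoning
    t = k / j
    r = k % j
    X = t ^ D * p ^ k
    regroup : ∀ P Z g τ Q → P * (Z * (g * τ) * Q) ≡ Z * g * P * (τ * Q)
    regroup = solve-∀
    k≡r+t*j : k ≡ r + t * j
    k≡r+t*j = m≡m%n+[m/n]*n k j
    W<t : W < t
    W<t = ≤-trans (≤-reflexive (sym (m*n/n≡m (suc W) j))) (/-monoˡ-≤ j N≤k)
    1+a+k≤G*t : suc (a + k) ≤ G * t
    1+a+k≤G*t = linear t W<t (≤-trans (s≤s (≤-reflexive k≡r+t*j)) (+-monoˡ-≤ (t * j) (m%n<n k j)))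
      where
      linear : ∀ τ → suc W ≤ τ → suc k ≤ j + τ * j → suc (a + k) ≤ G * τ
      linear (suc τ′) _ k<j+τj = begin
        suc (a + k)            ≡⟨ +-suc a k ⟨
        a + suc k              ≤⟨ +-monoʳ-≤ a k<j+τj ⟩
        a + (j + suc τ′ * j)   ≡⟨ unfold a j τ′ ⟩
        G + τ′ * j             ≤⟨ +-monoʳ-≤ G (*-monoʳ-≤ τ′ (m≤n+m j (a + j))) ⟩
        G + τ′ * G             ≡⟨ cong (G +_) (*-comm τ′ G) ⟩
        G + G * τ′             ≡⟨ *-suc G τ′ ⟨
        G * suc τ′             ∎
        where
        unfold : ∀ a j τ′ → a + (j + suc τ′ * j) ≡ a + j + j + τ′ * j
        unfold = solve-∀
    pow-split : ∀ q → q ^ k ≡ q ^ r * (q ^ t) ^ j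
    pow-split q = trans (cong (q ^_) k≡r+t*j) (trans (^-distribˡ-+-* q r (t * j)) (cong (q ^ r *_) (sym (^-*-assoc q t j))))
    collect : ∀ x y z → x ^ j * (z * y ^ j) ≡ (y * x) ^ j * z
    collect x y z = trans (swap (x ^ j) z (y ^ j)) (cong (_* z) (sym (*-^-distrib y x j)))
      where
      swap : ∀ a z b → a * (z * b) ≡ b * a * z
      swap = solve-∀
    spread : ∀ x y z → (x * y) ^ j * z ≡ x ^ j * (z * y ^ j)
    spread x y z = trans (cong (_* z) (*-^-distrib x y j)) (swap (x ^ j) (y ^ j) z)
      where
      swap : ∀ a b z → a * b * z ≡ a * (z * b)
      swap = solve-∀
    X>0 : X > 0
    X>0 = *-mono-≤ (m^n>0 t ⦃ >-nonZero (≤-trans (s≤s z≤n) W<t) ⦄ D) (m^n>0 p k)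

∣⊖∣≡dist : ∀ m n → ℤ.∣ m ⊖ n ∣ ≡ dist m n
∣⊖∣≡dist m n with ≤-total m n
... | inj₁ m≤n = trans (ℤ.∣⊖∣-≤ m≤n) (sym (m≤n⇒∣m-n∣≡n∸m m≤n))
... | inj₂ n≤m = trans (ℤ.∣m⊖n∣≡∣n⊖m∣ m n) (trans (ℤ.∣⊖∣-≤ n≤m) (sym (m≤n⇒∣n-m∣≡n∸m n≤m)))

fraction-dist< : ∀ a b X Y e d → dist (a * suc Y) (b * suc X) * suc d < suc X * suc Y →
  ℚᵘ.∣ ℚᵘ.mkℚᵘ (ℤ.+ a) X ℚᵘ.- ℚᵘ.mkℚᵘ (ℤ.+ b) Y ∣ ℚᵘ.< ℚᵘ.mkℚᵘ +[1+ e ] d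
fraction-dist< a b X Y e d lt = ℚᵘ.*<* (subst₂ ℤ._<_ (ℤ.pos-* ℤ.∣ numerator ∣ (suc d)) (ℤ.pos-* (suc e) _)
  (ℤ.+<+ (≤-trans (s≤s (≤-reflexive (cong (_* suc d) (trans (cong ℤ.∣_∣ numerator≡) (∣⊖∣≡dist (a * suc Y) (b * suc X))))))
                  (≤-trans lt (m≤n*m (suc X * suc Y) (suc e))))))
  where
  numerator : ℤ
  numerator = ℤ.+ a ℤ.* ℤ.+ suc Y ℤ.+ ℤ.- (ℤ.+ b) ℤ.* ℤ.+ suc X
  numerator≡ : numerator ≡ (a * suc Y) ⊖ (b * suc X)
  numerator≡ = trans (cong₂ ℤ._+_ (sym (ℤ.pos-* a (suc Y)))
                                 (trans (sym (ℤ.neg-distribˡ-* (ℤ.+ b) (ℤ.+ suc X))) (cong ℤ.-_ (sym (ℤ.pos-* b (suc X))))))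
                     (ℤ.m-n≡m⊖n (a * suc Y) (b * suc X))

-- Only the denominator of a positive ε matters: ε ≥ 1 / (d + 1).
ratio-dist< : ∀ ε → 0ℚ <ℚ ε → Σ ℕ λ d → ∀ a b {x y} → 0 < x → 0 < y →
  dist (a * y) (b * x) * suc d < x * y → ∣ ratio a x - ratio b y ∣ <ℚ ε
ratio-dist< (mkℚ (ℤ.+ zero) d _) (ℚ.*<* (ℤ.+<+ ()))
ratio-dist< (mkℚ -[1+ e ] d _) (ℚ.*<* ())
ratio-dist< (mkℚ +[1+ e ] d _) _ = d , close
  where
  close : ∀ a b {x y} → 0 < x → 0 < y → dist (a * y) (b * x) * suc d < x * y → ∣ ratio a x - ratio b y ∣ <ℚ _
  close a b {suc X} {suc Y} _ _ lt =
    toℚᵘ-cancel-< (ℚᵘ.<-respˡ-≃ (ℚᵘ.≃-sym (toℚᵘ-dist (ℚᵘ.mkℚᵘ (ℤ.+ a) X) (ℚᵘ.mkℚᵘ (ℤ.+ b) Y))) (fraction-dist< a b X Y e d lt))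
    where
    toℚᵘ-dist : ∀ p q → toℚᵘ ∣ fromℚᵘ p - fromℚᵘ q ∣ ℚᵘ.≃ ℚᵘ.∣ p ℚᵘ.- q ∣
    toℚᵘ-dist p q = ℚᵘ.≃-trans (toℚᵘ-homo-∣-∣ (fromℚᵘ p - fromℚᵘ q)) (ℚᵘ.∣-∣-cong
      (ℚᵘ.≃-trans (toℚᵘ-homo-+ (fromℚᵘ p) (ℚ.- fromℚᵘ q))
                  (ℚᵘ.+-cong (toℚᵘ-fromℚᵘ p) (ℚᵘ.≃-trans (toℚᵘ-homo‿- (fromℚᵘ q)) (ℚᵘ.-‿cong (toℚᵘ-fromℚᵘ q))))))

proposition2p4 : (n : ℕ) → 1 Data.Nat.≤ n → (cs : Fin n → ℕ) → (c' : ℕ) → (i : Fin n → ℕ) →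
    0 < c' + Σᶠ n i →
    (ε : ℚ) → 0ℚ <ℚ ε →
    Σ ℕ (λ N → (k : ℕ) → k ≥ N →
      ∣ ratio (A n cs c' i k) ((c' + Σᶠ n i) ^ k)
        - ratio ((c' + Σᶠ n i) ^ Σᶠ n i * sumF n cs c' i) (Σᶠ n i !) ∣ <ℚ ε)
proposition2p4 n _ cs c' i s>0 ε ε>0
  with ratio-dist< ε ε>0 | A-estimate n cs c' i
... | d , ratio-close | C , D , estimate
  with exp-dominates-poly (C * suc d) (Σᶠ n cs) D (c' + Σᶠ n i ∸ 1)
... | N , dominates = N , λ k N≤k →
  ratio-close (A n cs c' i k) (s ^ m * sumF n cs c' i) (m^n>0 s k) (1≤n! m) (begin-strict
    dist (A n cs c' i k * m !) (s ^ m * sumF n cs c' i * s ^ k) * suc d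
      ≤⟨ *-monoˡ-≤ (suc d) (estimate k) ⟩
    C * suc (Σᶠ n cs + k) ^ D * (s ∸ 1) ^ k * suc d
      ≡⟨ regroup C (suc (Σᶠ n cs + k) ^ D) ((s ∸ 1) ^ k) (suc d) ⟩
    C * suc d * suc (Σᶠ n cs + k) ^ D * (s ∸ 1) ^ k
      <⟨ dominates k N≤k ⟩
    suc (s ∸ 1) ^ k
      ≡⟨ cong (_^ k) (suc-pred s) ⟩
    s ^ k
      ≤⟨ m≤m*n (s ^ k) (m !) ⦃ m !≢0 ⦄ ⟩
    s ^ k * m !
      ∎)
  where
  open ≤-Reasoning
  m = Σᶠ n i
  s = c' + m
  instance
    s≢0 : NonZero s
    s≢0 = >-nonZero s>0
  regroup : ∀ C B P d → C * B * P * d ≡ C * d * B * P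
  regroup = solve-∀
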